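{- Let $n\geqslant 1$ and $m\geqslant 2$. For a $T$-torsion $n$-flag $\mathcal{V}=(V_1\subset\cdots\subset V_n)$ in $S^m$ with an ordered basis $(\nu_1,\dots,\nu_n)$, let $N\in\mathbf{U}^o_n$ be defined by $T(\nu_1,\dots,\nu_n)=(\nu_1,\dots,\nu_n)N$. Then the assignment $[\mathcal{V}]\mapsto [N]$ is a well-defined bijection between the set of $T$-torsion $n$-flag classes in $S^m$ and the set of $\mathbf{U}^*_n$-conjugacy classes of matrices in $\mathbf{U}^o_{n,m}$, the set of nilpotent upper-triangular $n\times n$ matrices over $\mathbb{F}_q$ of rank $\geqslant n-m$. Under this correspondence, the $T$-order of $[\mathcal{V}]$ equals $n-\mathrm{rank}\,N$.
   Context: $q$ is a prime power, $A=\mathbb{F}_q[T]$. $S^1=\mathbb{F}_q[1/T]/\mathbb{F}_q$ (i.e. $\varinjlim_n T^{ -n}A/A$) as an $A$-module, and $S^m=(S^1)^{\oplus m}$. An $n$-flag in $S^m$ is a chain $V_1\subset\cdots\subset V_n$ of $\mathbb{F}_q$-subspaces with $\dim V_i=i$; an ordered basis is a basis $(\nu_1,\dots,\nu_n)$ of $V_n$ with $V_i=\mathrm{span}(\nu_1,\dots,\nu_i)$. A $T$-torsion $n$-flag is an $n$-flag with $TV_1=0$ and $TV_i\subseteq V_{i-1}$ for $2\le i\le n$. Two $T$-torsion $n$-flags $(V_i)$, $(W_i)$ are isomorphic if there is an $\mathbb{F}_q$-linear isomorphism $\iota:V_n\to W_n$ with $\iota(V_i)=W_i$ for all $i$ and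 $\iota\circ T=T\circ\iota$; a $T$-torsion $n$-flag class $[\mathcal{V}]$ is an isomorphism class. The $T$-order of $\mathcal{V}$ (and of $[\mathcal{V}]$) is $n-\dim_{\mathbb{F}_q}TV_n$. $\mathbf{U}^o_n$ is the set of nilpotent upper-triangular $n\times n$ matrices over $\mathbb{F}_q$, on which the group $\mathbf{U}^*_n$ of invertible upper-triangular matrices acts by conjugation $B.N=B^{ -1}NB$. -}

module Defs where

open import Level using (0ℓ)
open import Data.Nat using (ℕ; zero; suc; _≤_; _∸_)
open import Data.Fin using (Fin; zero; suc; toℕ; inject₁; fromℕ)
open import Data.Fin.Properties using ()
import Data.Nat.Properties
import Data.Nat
import Data.Fin
import Relation.Nullary
import Relation.Binary.PropositionalEquality
open import Data.Product using (Σ; ∃; _×_; _,_; proj₁)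
open import Relation.Nullary using (¬_)
open import Relation.Binary.PropositionalEquality using (_≡_)
open import Function.Bundles using (Inverse)
open import Relation.Binary.Bundles using (Setoid)
open import Algebra.Bundles using (CommutativeRing)

-- A finite field F_q : a commutative ring (with setoid
-- equality _≈_) in which 0 ≉ 1, every nonzero element is invertible,
-- and whose carrier (modulo ≈) is in bijection with Fin q for some q.
-- (q is then automatically a prime power, and every prime power arises.)

record FiniteField : Set₁ where
  field
    cring : CommutativeRing 0ℓ 0ℓ
  open CommutativeRing cring public
  field
    0≉1      : ¬ (0# ≈ 1#)
    inverse  : ∀ x → ¬ (x ≈ 0#) → Σ Carrier (λ y → x * y ≈ 1#)
    q        : ℕ
    enumerate : Inverse setoid (Relation.Binary.PropositionalEquality.setoid (Fin q))

module Over (F : FiniteField) where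
  open FiniteField F hiding (zero)

  ∑ : ∀ {k} → (Fin k → Carrier) → Carrier
  ∑ {zero}  f = 0#
  ∑ {suc k} f = f zero + ∑ (λ i → f (suc i))

  Mat : ℕ → Set
  Mat n = Fin n → Fin n → Carrier

  _≈M_ : ∀ {n} → Mat n → Mat n → Set
  A ≈M B = ∀ i j → A i j ≈ B i j

  _⊛_ : ∀ {n} → Mat n → Mat n → Mat n
  (A ⊛ B) i j = ∑ (λ k → A i k * B k j)

  Id : ∀ {n} → Mat n
  Id i j with i Data.Fin.≟ j
  ... | Relation.Nullary.yes _ = 1#
  ... | Relation.Nullary.no  _ = 0#

  Zero : ∀ {n} → Mat n
  Zero _ _ = 0#

  _^M_ : ∀ {n} → Mat n → ℕ → Mat n
  A ^M zero  = Id
  A ^M suc k = A ⊛ (A ^M k)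

  UpperTriangular : ∀ {n} → Mat n → Set
  UpperTriangular A = ∀ i j → toℕ j Data.Nat.< toℕ i → A i j ≈ 0#

  Nilpotent : ∀ {n} → Mat n → Set
  Nilpotent A = Σ ℕ (λ k → (A ^M k) ≈M Zero)

  Invertible : ∀ {n} → Mat n → Set
  Invertible A = Σ (Mat _) (λ B → ((A ⊛ B) ≈M Id) × ((B ⊛ A) ≈M Id))

  Uo : ∀ n → Mat n → Set
  Uo n N = UpperTriangular N × Nilpotent N

  Ustar : ∀ n → Mat n → Set
  Ustar n B = UpperTriangular B × Invertible B

  Conj : ∀ {n} → Mat n → Mat n → Set
  Conj {n} N M =
    Σ (Mat n) λ B → Σ (Mat n) λ B⁻¹ →
      UpperTriangular B × ((B ⊛ B⁻¹) ≈M Id) × ((B⁻¹ ⊛ B) ≈M Id) ×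
      (M ≈M ((B⁻¹ ⊛ N) ⊛ B))

  record VSpace : Set₁ where
    field
      V    : Set
      _≋_  : V → V → Set
      _⊕_  : V → V → V
      𝟎    : V
      _∙_  : Carrier → V → V

  module LinAlg (W : VSpace) where
    open VSpace W

    ∑V : ∀ {k} → (Fin k → V) → V
    ∑V {zero}  f = 𝟎
    ∑V {suc k} f = f zero ⊕ ∑V (λ i → f (suc i))

    InSpan : ∀ {k} → (Fin k → V) → V → Set
    InSpan {k} v x = Σ (Fin k → Carrier) λ c → x ≋ ∑V (λ i → c i ∙ v i)

    LinIndep : ∀ {k} → (Fin k → V) → Set
    LinIndep {k} v = ∀ (c : Fin k → Carrier) →
      ∑V (λ i → c i ∙ v i) ≋ 𝟎 → ∀ i → c i ≈ 0#

    SubDim : (V → Set) → ℕ → Set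
    SubDim P r = Σ (Fin r → V) λ b →
      LinIndep b × (∀ i → P (b i)) × (∀ x → P x → InSpan b x)

    SpanDim : ∀ {k} → (Fin k → V) → ℕ → Set
    SpanDim v r = Σ (Fin r → V) λ b →
      LinIndep b × (∀ i → InSpan v (b i)) × (∀ i → InSpan b (v i))

  Col : ℕ → VSpace
  Col n = record
    { V = Fin n → Carrier
    ; _≋_ = λ x y → ∀ i → x i ≈ y i
    ; _⊕_ = λ x y i → x i + y i
    ; 𝟎 = λ _ → 0#
    ; _∙_ = λ c x i → c * x i
    }

  Rank : ∀ {n} → Mat n → ℕ → Set
  Rank {n} N r = LinAlg.SpanDim (Col n) (λ j i → N i j) r

  Uo[_,_] : ∀ n → ℕ → Mat n → Set
  Uo[ n , m ] N = Uo n N × Σ ℕ (λ r → Rank N r × (n ∸ m) ≤ r)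

  -- S^1 = F[1/T]/F and S^m = (S^1)^m.
  -- An element of S^m is Σ_{k ≥ 1} c_k T^{-k} with c_k ∈ F^m finitely
  -- supported; we store coeff k j = (j-th component of) c_{k+1}.
  record Sm (m : ℕ) : Set where
    field
      coeff   : ℕ → Fin m → Carrier
      bound   : ℕ
      support : ∀ k → bound ≤ k → ∀ j → coeff k j ≈ 0#
  open Sm public

  _≈S_ : ∀ {m} → Sm m → Sm m → Set
  x ≈S y = ∀ k j → coeff x k j ≈ coeff y k j

  0S : ∀ {m} → Sm m
  0S = record { coeff = λ _ _ → 0# ; bound = 0 ; support = λ _ _ _ → refl }

  _+S_ : ∀ {m} → Sm m → Sm m → Sm m
  x +S y = record
    { coeff = λ k j → coeff x k j + coeff y k j
    ; bound = bound x Data.Nat.⊔ bound y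
    ; support = λ k b≤k j → trans
        (+-cong (support x k (Data.Nat.Properties.≤-trans (Data.Nat.Properties.m≤m⊔n _ _) b≤k) j)
                (support y k (Data.Nat.Properties.≤-trans (Data.Nat.Properties.m≤n⊔m _ _) b≤k) j))
        (+-identityˡ 0#)
    }

  _·S_ : ∀ {m} → Carrier → Sm m → Sm m
  c ·S x = record
    { coeff = λ k j → c * coeff x k j
    ; bound = bound x
    ; support = λ k b≤k j → trans (*-congˡ (support x k b≤k j)) (zeroʳ c)
    }

  -- multiplication by T:  T · Σ_{k≥1} c_k T^{-k} = Σ_{k≥1} c_{k+1} T^{-k}
  -- (the term c_1 T^0 is a constant and vanishes in F[1/T]/F)
  TS : ∀ {m} → Sm m → Sm m
  TS x = record
    { coeff = λ k j → coeff x (suc k) j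
    ; bound = bound x
    ; support = λ k b≤k j → support x (suc k) (Data.Nat.Properties.≤-trans b≤k (Data.Nat.Properties.n≤1+n k)) j
    }

  SmSpace : ℕ → VSpace
  SmSpace m = record { V = Sm m ; _≋_ = _≈S_ ; _⊕_ = _+S_ ; 𝟎 = 0S ; _∙_ = _·S_ }

  module _ {m : ℕ} where
    open LinAlg (SmSpace m) public

  -- Flags in S^m given by an ordered basis ν : Fin n → S^m.
  -- V_i = span(ν_1, …, ν_i)  (i = 0 … n; V_0 = 0).
  first : ∀ {A : Set} {n} (i : ℕ) → i ≤ n → (Fin n → A) → Fin i → A
  first i i≤n ν j = ν (Data.Fin.inject≤ j i≤n)

  _∈V[_,_] : ∀ {m n} → Sm m → (Fin n → Sm m) → Σ ℕ (λ i → i ≤ n) → Set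
  x ∈V[ ν , (i , i≤n) ] = InSpan (first i i≤n ν) x

  -- ν is an ordered basis of an n-flag (V_1 ⊂ ⋯ ⊂ V_n), i.e. dim V_i = i
  IsFlagBasis : ∀ {m n} → (Fin n → Sm m) → Set
  IsFlagBasis ν = LinIndep ν

  IsTorsionFlagBasis : ∀ {m n} → (Fin n → Sm m) → Set
  IsTorsionFlagBasis {m} {n} ν = IsFlagBasis ν ×
    (∀ i (i<n : i Data.Nat.< n) (x : Sm m) →
       x ∈V[ ν , (suc i , i<n) ] →
       TS x ∈V[ ν , (i , Data.Nat.Properties.<⇒≤ i<n) ])

  full : ∀ n → Σ ℕ (λ i → i ≤ n)
  full n = n , Data.Nat.Properties.≤-refl

  record FlagIso {m n} (ν μ : Fin n → Sm m) : Set where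
    field
      ι      : (x : Sm m) → x ∈V[ ν , full n ] → Sm m
      resp   : ∀ x y px py → x ≈S y → ι x px ≈S ι y py
      additive : ∀ x y px py pxy → ι (x +S y) pxy ≈S (ι x px +S ι y py)
      homogeneous : ∀ c x px pcx → ι (c ·S x) pcx ≈S (c ·S ι x px)
      injective : ∀ x y px py → ι x px ≈S ι y py → x ≈S y
      maps-into : ∀ (i : Σ ℕ (λ i → i ≤ n)) x px → x ∈V[ ν , i ] → ι x px ∈V[ μ , i ]
      maps-onto : ∀ (i : Σ ℕ (λ i → i ≤ n)) w → w ∈V[ μ , i ] →
                    Σ (Sm m) λ x → Σ (x ∈V[ ν , full n ]) λ px →
                      x ∈V[ ν , i ] × (ι x px ≈S w)
      commutes : ∀ x px pTx → ι (TS x) pTx ≈S TS (ι x px)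

  MatrixOfT : ∀ {m n} → (Fin n → Sm m) → Mat n → Set
  MatrixOfT ν N = ∀ j → TS (ν j) ≈S ∑V (λ i → N i j ·S ν i)

  DimTV : ∀ {m n} → (Fin n → Sm m) → ℕ → Set
  DimTV {m} {n} ν r = SubDim (λ y → Σ (Sm m) λ x → x ∈V[ ν , full n ] × (y ≈S TS x)) r

  HasTOrder : ∀ {m n} → (Fin n → Sm m) → ℕ → Set
  HasTOrder {m} {n} ν t = Σ ℕ λ r → DimTV ν r × (t ≡ n ∸ r)

{-# OPTIONS --safe #-}
-- The matrix N of T in an ordered basis ν of a torsion flag is strictly upper triangular because
-- T V_i ⊆ V_{i-1}, and a flag isomorphism is the same thing as an upper-triangular change of basis
-- intertwining the two matrices of T, so flag classes correspond to U*_n-conjugacy classes.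
-- The rank bound comes from the socle ker T ≅ F^m of S^m: a column of N that depends on the earlier
-- columns, N e_J = N b with b supported below J, gives the vector ν(e_J − b) of ker T, and these vectors
-- are independent, so there are at most m such columns.  Conversely a basis realising a given N is built
-- column by column from preimages under T, adding a new socle vector for every dependent column.
-- Finally T V_n is the image under ν of the column space of N, so dim T V_n = rank N.
module Submission where

open import Defs
open import Level using (0ℓ)
open import Data.Nat as ℕ using (ℕ; zero; suc; _≤_; _<_; _∸_; z≤n; s≤s)
import Data.Nat.Properties as ℕₚ
open import Data.Fin as Fin using (Fin; zero; suc; toℕ; fromℕ<; inject≤)
import Data.Fin.Properties as Finₚ
open import Data.Product using (Σ; _×_; _,_; proj₁; proj₂)
open import Data.Sum using (_⊎_; inj₁; inj₂)
open import Data.Unit using (⊤; tt)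
open import Data.Vec.Functional using (_∷_)
open import Data.Empty using (⊥-elim)
open import Relation.Nullary using (¬_; yes; no; Dec; ¬?)
open import Relation.Nullary.Decidable using (_×-dec_; _→-dec_; decidable-stable)
open import Relation.Binary.PropositionalEquality as ≡ using (_≡_; _≢_)
open import Relation.Binary.Bundles using (Setoid)
open import Relation.Binary.Definitions using (tri<; tri≈; tri>)
import Algebra.Definitions.RawSemiring as RawSemiringDefinitions
import Algebra.Bundles
open import Function.Bundles using (Inverse)
import Relation.Binary.Reasoning.Setoid as SetoidReasoning

∸-≤-of-sum : ∀ {p d n m} → p ℕ.+ d ≡ n → d ≤ m → n ∸ m ≤ p
∸-≤-of-sum {p} {d} ≡.refl d≤m =
  ℕₚ.≤-trans (ℕₚ.∸-monoʳ-≤ (p ℕ.+ d) d≤m) (ℕₚ.≤-reflexive (ℕₚ.m+n∸n≡m p d))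

summand-≤ : ∀ {p d n m r} → p ℕ.+ d ≡ n → n ∸ m ≤ r → r ≤ p → d ≤ m
summand-≤ {p} {d} {n} {m} ≡.refl n∸m≤r r≤p = ℕₚ.+-cancelˡ-≤ p d m (ℕₚ.≤-trans (ℕₚ.m≤n+m∸n (p ℕ.+ d) m)
  (ℕₚ.≤-trans (ℕₚ.+-monoʳ-≤ m (ℕₚ.≤-trans n∸m≤r r≤p)) (ℕₚ.≤-reflexive (ℕₚ.+-comm m p))))

module _ (F : FiniteField) where
  open FiniteField F hiding (zero)
  open Over F hiding (∑V; InSpan; LinIndep; SubDim; SpanDim)
  open RawSemiringDefinitions (Algebra.Bundles.Semiring.rawSemiring semiring) using (_^_)

  module ≈-Reasoning = SetoidReasoning setoid

  _≟_ : (a b : Carrier) → Dec (a ≈ b)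
  a ≟ b with Inverse.to enumerate a Fin.≟ Inverse.to enumerate b
  ... | yes e = yes (trans (sym (from-to a)) (trans (Inverse.from-cong enumerate e) (from-to b)))
    where
    from-to : ∀ x → Inverse.from enumerate (Inverse.to enumerate x) ≈ x
    from-to x = Inverse.inverseʳ enumerate ≡.refl
  ... | no ne = no (λ a≈b → ne (Inverse.to-cong enumerate a≈b))

  inv : ∀ a → ¬ a ≈ 0# → Carrier
  inv a a≉0 = proj₁ (inverse a a≉0)

  *-inverseʳ : ∀ a (a≉0 : ¬ a ≈ 0#) → a * inv a a≉0 ≈ 1#
  *-inverseʳ a a≉0 = proj₂ (inverse a a≉0)

  *-inverseˡ : ∀ a (a≉0 : ¬ a ≈ 0#) → inv a a≉0 * a ≈ 1#
  *-inverseˡ a a≉0 = trans (*-comm _ _) (*-inverseʳ a a≉0)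

  *-cancelˡ-0 : ∀ a b → ¬ a ≈ 0# → a * b ≈ 0# → b ≈ 0#
  *-cancelˡ-0 a b a≉0 ab≈0 = begin
    b                   ≈⟨ *-identityˡ b ⟨
    1# * b              ≈⟨ *-congʳ (*-inverseˡ a a≉0) ⟨
    (inv a a≉0 * a) * b ≈⟨ *-assoc _ _ _ ⟩
    inv a a≉0 * (a * b) ≈⟨ *-congˡ ab≈0 ⟩
    inv a a≉0 * 0#      ≈⟨ zeroʳ _ ⟩
    0#                  ∎
    where open ≈-Reasoning

  x+-1*x≈0 : ∀ x → x + (- 1#) * x ≈ 0#
  x+-1*x≈0 x = begin
    x + (- 1#) * x       ≈⟨ +-congʳ (*-identityˡ x) ⟨
    1# * x + (- 1#) * x  ≈⟨ distribʳ x 1# (- 1#) ⟨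
    (1# + - 1#) * x      ≈⟨ *-congʳ (-‿inverseʳ 1#) ⟩
    0# * x               ≈⟨ zeroˡ x ⟩
    0#                   ∎
    where open ≈-Reasoning

  x+-1*y+y≈x : ∀ x y → (x + (- 1#) * y) + y ≈ x
  x+-1*y+y≈x x y = begin
    (x + (- 1#) * y) + y      ≈⟨ +-assoc _ _ _ ⟩
    x + ((- 1#) * y + y)      ≈⟨ +-congˡ (trans (+-comm _ _) (x+-1*x≈0 y)) ⟩
    x + 0#                    ≈⟨ +-identityʳ x ⟩
    x                         ∎
    where open ≈-Reasoning

  x+-1*y≈0⇒x≈y : ∀ {x y} → x + (- 1#) * y ≈ 0# → x ≈ y
  x+-1*y≈0⇒x≈y {x} {y} h = trans (sym (x+-1*y+y≈x x y)) (trans (+-congʳ h) (+-identityˡ y))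

  *-left-comm : ∀ x y z → x * (y * z) ≈ y * (x * z)
  *-left-comm x y z = trans (sym (*-assoc x y z)) (trans (*-congʳ (*-comm x y)) (*-assoc y x z))

  x+ay≈[x+az]+a[y-z] : ∀ x a y z → x + a * y ≈ (x + a * z) + a * (y + (- 1#) * z)
  x+ay≈[x+az]+a[y-z] x a y z = sym (begin
    (x + a * z) + a * (y + (- 1#) * z)          ≈⟨ +-congˡ (distribˡ a y ((- 1#) * z)) ⟩
    (x + a * z) + (a * y + a * ((- 1#) * z))    ≈⟨ +-congˡ (+-comm _ _) ⟩
    (x + a * z) + (a * ((- 1#) * z) + a * y)    ≈⟨ +-assoc _ _ _ ⟩
    x + (a * z + (a * ((- 1#) * z) + a * y))    ≈⟨ +-congˡ (+-assoc _ _ _) ⟨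
    x + ((a * z + a * ((- 1#) * z)) + a * y)    ≈⟨ +-congˡ (+-congʳ (distribˡ a z ((- 1#) * z))) ⟨
    x + (a * (z + (- 1#) * z) + a * y)          ≈⟨ +-congˡ (+-congʳ (trans (*-congˡ (x+-1*x≈0 z)) (zeroʳ a))) ⟩
    x + (0# + a * y)                            ≈⟨ +-congˡ (+-identityˡ _) ⟩
    x + a * y                                   ∎)
    where open ≈-Reasoning

  x+0*y≈x : ∀ x {a} y → a ≈ 0# → x + a * y ≈ x
  x+0*y≈x x y a≈0 = trans (+-congˡ (trans (*-congʳ a≈0) (zeroˡ y))) (+-identityʳ x)

  x+a*0≈x : ∀ x a {y} → y ≈ 0# → x + a * y ≈ x
  x+a*0≈x x a y≈0 = trans (+-congˡ (trans (*-congˡ y≈0) (zeroʳ a))) (+-identityʳ x)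

  x+y+-1*y≈x : ∀ x y → (x + y) + (- 1#) * y ≈ x
  x+y+-1*y≈x x y = trans (+-assoc _ _ _) (trans (+-congˡ (x+-1*x≈0 y)) (+-identityʳ x))

  0+a*1≈0⇒a≈0 : ∀ {x a y} → x ≈ 0# → y ≈ 1# → x + a * y ≈ 0# → a ≈ 0#
  0+a*1≈0⇒a≈0 {x} {a} {y} x≈0 y≈1 x+ay≈0 = begin
    a            ≈⟨ *-identityʳ a ⟨
    a * 1#       ≈⟨ *-congˡ y≈1 ⟨
    a * y        ≈⟨ +-identityˡ _ ⟨
    0# + a * y   ≈⟨ +-congʳ x≈0 ⟨
    x + a * y    ≈⟨ x+ay≈0 ⟩
    0#           ∎
    where open ≈-Reasoning

  -- The field is finite, so existential statements over coefficient vectors are decidable.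
  RespectsCoefficients : ∀ {k} → ((Fin k → Carrier) → Set) → Set
  RespectsCoefficients {k} P = ∀ c d → (∀ i → c i ≈ d i) → P c → P d

  ∃-scalar? : (Q : Carrier → Set) → (∀ a b → a ≈ b → Q a → Q b) → (∀ a → Dec (Q a)) → Dec (Σ Carrier Q)
  ∃-scalar? Q resp Q? with Finₚ.any? (λ i → Q? (Inverse.from enumerate i))
  ... | yes (i , q) = yes (_ , q)
  ... | no ¬q = no λ (a , q) → ¬q (Inverse.to enumerate a , resp a _ (sym (Inverse.inverseʳ enumerate ≡.refl)) q)

  ∃-vector? : ∀ k (P : (Fin k → Carrier) → Set) → RespectsCoefficients P → (∀ c → Dec (P c)) →
    Dec (Σ (Fin k → Carrier) P)
  ∃-vector? zero P resp P? with P? (λ ())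
  ... | yes p = yes ((λ ()) , p)
  ... | no ¬p = no λ (c , p) → ¬p (resp c _ (λ ()) p)
  ∃-vector? (suc k) P resp P? with ∃-scalar? Head resp-head head?
    where
    cons : Carrier → (Fin k → Carrier) → Fin (suc k) → Carrier
    cons a c zero = a
    cons a c (suc i) = c i
    Head : Carrier → Set
    Head a = Σ (Fin k → Carrier) λ c → P (cons a c)
    resp-head : ∀ a b → a ≈ b → Head a → Head b
    resp-head a b a≈b (c , p) = c , resp (cons a c) (cons b c) (λ { zero → a≈b ; (suc i) → refl }) p
    head? : ∀ a → Dec (Head a)
    head? a = ∃-vector? k (λ c → P (cons a c))
      (λ c d c≈d → resp (cons a c) (cons a d) λ { zero → refl ; (suc i) → c≈d i })
      (λ c → P? (cons a c))
  ... | yes (_ , _ , p) = yes (_ , p)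
  ... | no ¬p = no λ (c , p) → ¬p (c zero , (λ i → c (suc i)) , resp c _ (λ { zero → refl ; (suc i) → refl }) p)

  Id-diag : ∀ {n} (i : Fin n) → Id i i ≈ 1#
  Id-diag i with i Fin.≟ i
  ... | yes _ = refl
  ... | no i≢i = ⊥-elim (i≢i ≡.refl)

  Id-off : ∀ {n} (i j : Fin n) → i ≢ j → Id i j ≈ 0#
  Id-off i j i≢j with i Fin.≟ j
  ... | yes i≡j = ⊥-elim (i≢j i≡j)
  ... | no _ = refl

  δ : ∀ {n} → Fin n → Fin n → Carrier
  δ j i = Id i j

  SupportedBelow : ∀ {n} → ℕ → (Fin n → Carrier) → Set
  SupportedBelow j c = ∀ k → j ≤ toℕ k → c k ≈ 0#

  δ-supportedBelow : ∀ {n} (j : Fin n) → SupportedBelow (suc (toℕ j)) (δ j)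
  δ-supportedBelow j k j<k = Id-off k j (λ k≡j → ℕₚ.<⇒≢ j<k (≡.sym (≡.cong toℕ k≡j)))

  pad : ∀ {i n} → .(i ≤ n) → (Fin i → Carrier) → Fin n → Carrier
  pad {zero} _ c j = 0#
  pad {suc i} {suc n} i≤n c zero = c zero
  pad {suc i} {suc n} i≤n c (suc j) = pad (ℕ.s≤s⁻¹ i≤n) (λ k → c (suc k)) j

  pad-supportedBelow : ∀ {i n} .(i≤n : i ≤ n) (c : Fin i → Carrier) → SupportedBelow i (pad i≤n c)
  pad-supportedBelow {zero} i≤n c j _ = refl
  pad-supportedBelow {suc i} {suc n} i≤n c (suc j) (s≤s i≤j) =
    pad-supportedBelow (ℕ.s≤s⁻¹ i≤n) (λ k → c (suc k)) j i≤j

  pad-restrict : ∀ {i n} .(i≤n : i ≤ n) (d : Fin n → Carrier) → SupportedBelow i d →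
    ∀ j → pad i≤n (λ k → d (inject≤ k i≤n)) j ≈ d j
  pad-restrict {zero} i≤n d d↓ j = sym (d↓ j z≤n)
  pad-restrict {suc i} {suc n} i≤n d d↓ zero = refl
  pad-restrict {suc i} {suc n} i≤n d d↓ (suc j) =
    pad-restrict (ℕ.s≤s⁻¹ i≤n) (λ j → d (suc j)) (λ j i≤j → d↓ (suc j) (s≤s i≤j)) j

  record VectorSpaceLaws (W : VSpace) : Set where
    open VSpace W
    field
      ≋-refl  : ∀ {x} → x ≋ x
      ≋-sym   : ∀ {x y} → x ≋ y → y ≋ x
      ≋-trans : ∀ {x y z} → x ≋ y → y ≋ z → x ≋ z
      ⊕-cong  : ∀ {x y u v} → x ≋ y → u ≋ v → (x ⊕ u) ≋ (y ⊕ v)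
      ∙-cong  : ∀ {a b x y} → a ≈ b → x ≋ y → (a ∙ x) ≋ (b ∙ y)
      ⊕-assoc : ∀ x y z → ((x ⊕ y) ⊕ z) ≋ (x ⊕ (y ⊕ z))
      ⊕-comm  : ∀ x y → (x ⊕ y) ≋ (y ⊕ x)
      ⊕-identityˡ : ∀ x → (𝟎 ⊕ x) ≋ x
      ∙-distribˡ  : ∀ a x y → (a ∙ (x ⊕ y)) ≋ ((a ∙ x) ⊕ (a ∙ y))
      ∙-distribʳ  : ∀ a b x → ((a + b) ∙ x) ≋ ((a ∙ x) ⊕ (b ∙ x))
      ∙-assoc     : ∀ a b x → ((a * b) ∙ x) ≋ (a ∙ (b ∙ x))
      ∙-identity  : ∀ x → (1# ∙ x) ≋ x
      ∙-zeroˡ     : ∀ x → (0# ∙ x) ≋ 𝟎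
      ∙-zeroʳ     : ∀ a → (a ∙ 𝟎) ≋ 𝟎

  module LinearAlgebra (W : VSpace) (L : VectorSpaceLaws W) where
    open VSpace W public
    open VectorSpaceLaws L public
    open LinAlg W public

    ≋-setoid : Setoid 0ℓ 0ℓ
    ≋-setoid = record { Carrier = V ; _≈_ = _≋_
                      ; isEquivalence = record { refl = ≋-refl ; sym = ≋-sym ; trans = ≋-trans } }

    module ≋-Reasoning = SetoidReasoning ≋-setoid
    open ≋-Reasoning

    ⊕-identityʳ : ∀ x → (x ⊕ 𝟎) ≋ x
    ⊕-identityʳ x = ≋-trans (⊕-comm x 𝟎) (⊕-identityˡ x)

    ⊕-interchange : ∀ a b c d → ((a ⊕ b) ⊕ (c ⊕ d)) ≋ ((a ⊕ c) ⊕ (b ⊕ d))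
    ⊕-interchange a b c d = begin
      (a ⊕ b) ⊕ (c ⊕ d)   ≈⟨ ⊕-assoc a b (c ⊕ d) ⟩
      a ⊕ (b ⊕ (c ⊕ d))   ≈⟨ ⊕-cong ≋-refl (⊕-assoc b c d) ⟨
      a ⊕ ((b ⊕ c) ⊕ d)   ≈⟨ ⊕-cong ≋-refl (⊕-cong (⊕-comm b c) ≋-refl) ⟩
      a ⊕ ((c ⊕ b) ⊕ d)   ≈⟨ ⊕-cong ≋-refl (⊕-assoc c b d) ⟩
      a ⊕ (c ⊕ (b ⊕ d))   ≈⟨ ⊕-assoc a c (b ⊕ d) ⟨
      (a ⊕ c) ⊕ (b ⊕ d)   ∎

    ⊕-inverse : ∀ x → (x ⊕ ((- 1#) ∙ x)) ≋ 𝟎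
    ⊕-inverse x = begin
      x ⊕ ((- 1#) ∙ x)          ≈⟨ ⊕-cong (∙-identity x) ≋-refl ⟨
      (1# ∙ x) ⊕ ((- 1#) ∙ x)   ≈⟨ ∙-distribʳ _ _ x ⟨
      (1# + - 1#) ∙ x           ≈⟨ ∙-cong (-‿inverseʳ 1#) ≋-refl ⟩
      0# ∙ x                    ≈⟨ ∙-zeroˡ x ⟩
      𝟎                         ∎

    x⊕y≋𝟎⇒x≋-1∙y : ∀ x y → (x ⊕ y) ≋ 𝟎 → x ≋ ((- 1#) ∙ y)
    x⊕y≋𝟎⇒x≋-1∙y x y x⊕y≋𝟎 = begin
      x                        ≈⟨ ⊕-identityʳ x ⟨
      x ⊕ 𝟎                    ≈⟨ ⊕-cong ≋-refl (⊕-inverse y) ⟨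
      x ⊕ (y ⊕ ((- 1#) ∙ y))   ≈⟨ ⊕-assoc _ _ _ ⟨
      (x ⊕ y) ⊕ ((- 1#) ∙ y)   ≈⟨ ⊕-cong x⊕y≋𝟎 ≋-refl ⟩
      𝟎 ⊕ ((- 1#) ∙ y)         ≈⟨ ⊕-identityˡ _ ⟩
      (- 1#) ∙ y               ∎

    ∑V-cong : ∀ {k} {f g : Fin k → V} → (∀ i → f i ≋ g i) → ∑V f ≋ ∑V g
    ∑V-cong {zero} f≋g = ≋-refl
    ∑V-cong {suc k} f≋g = ⊕-cong (f≋g zero) (∑V-cong (λ i → f≋g (suc i)))

    ∑V-⊕ : ∀ {k} (f g : Fin k → V) → ∑V (λ i → f i ⊕ g i) ≋ (∑V f ⊕ ∑V g)
    ∑V-⊕ {zero} f g = ≋-sym (⊕-identityˡ 𝟎)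
    ∑V-⊕ {suc k} f g = ≋-trans (⊕-cong ≋-refl (∑V-⊕ (λ i → f (suc i)) (λ i → g (suc i))))
                               (⊕-interchange _ _ _ _)

    ∑V-∙ : ∀ {k} a (f : Fin k → V) → (a ∙ ∑V f) ≋ ∑V (λ i → a ∙ f i)
    ∑V-∙ {zero} a f = ∙-zeroʳ a
    ∑V-∙ {suc k} a f = ≋-trans (∙-distribˡ a _ _) (⊕-cong ≋-refl (∑V-∙ a (λ i → f (suc i))))

    ∑V-𝟎 : ∀ {k} (f : Fin k → V) → (∀ i → f i ≋ 𝟎) → ∑V f ≋ 𝟎
    ∑V-𝟎 {zero} f f≋𝟎 = ≋-refl
    ∑V-𝟎 {suc k} f f≋𝟎 = ≋-trans (⊕-cong (f≋𝟎 zero) (∑V-𝟎 _ (λ i → f≋𝟎 (suc i)))) (⊕-identityˡ 𝟎)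

    ∑V-swap : ∀ {k l} (f : Fin k → Fin l → V) →
      ∑V (λ i → ∑V (λ j → f i j)) ≋ ∑V (λ j → ∑V (λ i → f i j))
    ∑V-swap {zero} f = ≋-sym (∑V-𝟎 (λ j → ∑V (λ i → f i j)) (λ _ → ≋-refl))
    ∑V-swap {suc k} f = ≋-trans (⊕-cong ≋-refl (∑V-swap (λ i → f (suc i))))
                                (≋-sym (∑V-⊕ (λ j → f zero j) (λ j → ∑V (λ i → f (suc i) j))))

    ∑V-single : ∀ {k} (f : Fin k → V) (j : Fin k) → (∀ i → i ≢ j → f i ≋ 𝟎) → ∑V f ≋ f j
    ∑V-single {suc k} f zero f≋𝟎 =
      ≋-trans (⊕-cong ≋-refl (∑V-𝟎 _ (λ i → f≋𝟎 (suc i) (λ ())))) (⊕-identityʳ _)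
    ∑V-single {suc k} f (suc j) f≋𝟎 =
      ≋-trans (⊕-cong (f≋𝟎 zero (λ ()))
                      (∑V-single (λ i → f (suc i)) j (λ i i≢j → f≋𝟎 (suc i) (λ e → i≢j (Finₚ.suc-injective e)))))
              (⊕-identityˡ _)

    ∑-∙ : ∀ {k} (a : Fin k → Carrier) x → (∑ a ∙ x) ≋ ∑V (λ i → a i ∙ x)
    ∑-∙ {zero} a x = ∙-zeroˡ x
    ∑-∙ {suc k} a x = ≋-trans (∙-distribʳ _ _ x) (⊕-cong ≋-refl (∑-∙ (λ i → a (suc i)) x))

    lc : ∀ {k} → (Fin k → V) → (Fin k → Carrier) → V
    lc v c = ∑V (λ i → c i ∙ v i)

    lc-cong : ∀ {k} {v w : Fin k → V} {c d : Fin k → Carrier} →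
      (∀ i → v i ≋ w i) → (∀ i → c i ≈ d i) → lc v c ≋ lc w d
    lc-cong v≋w c≈d = ∑V-cong (λ i → ∙-cong (c≈d i) (v≋w i))

    lc-congʳ : ∀ {k} (v : Fin k → V) {c d : Fin k → Carrier} → (∀ i → c i ≈ d i) → lc v c ≋ lc v d
    lc-congʳ v = lc-cong (λ _ → ≋-refl)

    lc-+ : ∀ {k} (v : Fin k → V) (c d : Fin k → Carrier) → lc v (λ i → c i + d i) ≋ (lc v c ⊕ lc v d)
    lc-+ v c d = ≋-trans (∑V-cong (λ i → ∙-distribʳ (c i) (d i) (v i))) (∑V-⊕ (λ i → c i ∙ v i) (λ i → d i ∙ v i))

    lc-* : ∀ {k} (v : Fin k → V) a (c : Fin k → Carrier) → lc v (λ i → a * c i) ≋ (a ∙ lc v c)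
    lc-* v a c = ≋-trans (∑V-cong (λ i → ∙-assoc a (c i) (v i))) (≋-sym (∑V-∙ a (λ i → c i ∙ v i)))

    lc-sub : ∀ {k} (v : Fin k → V) (c d : Fin k → Carrier) →
      lc v (λ i → c i + (- 1#) * d i) ≋ (lc v c ⊕ ((- 1#) ∙ lc v d))
    lc-sub v c d = ≋-trans (lc-+ v c _) (⊕-cong ≋-refl (lc-* v (- 1#) d))

    lc-zero : ∀ {k} (v : Fin k → V) (c : Fin k → Carrier) → (∀ i → c i ≈ 0#) → lc v c ≋ 𝟎
    lc-zero v c c≈0 = ∑V-𝟎 _ (λ i → ≋-trans (∙-cong (c≈0 i) ≋-refl) (∙-zeroˡ (v i)))

    lc-lc : ∀ {k l} (v : Fin k → V) (E : Fin k → Fin l → Carrier) (c : Fin l → Carrier) →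
      lc (λ j → lc v (λ i → E i j)) c ≋ lc v (λ i → ∑ (λ j → E i j * c j))
    lc-lc v E c = begin
      ∑V (λ j → c j ∙ ∑V (λ i → E i j ∙ v i))      ≈⟨ ∑V-cong (λ j → ∑V-∙ (c j) (λ i → E i j ∙ v i)) ⟩
      ∑V (λ j → ∑V (λ i → c j ∙ (E i j ∙ v i)))    ≈⟨ ∑V-swap (λ j i → c j ∙ (E i j ∙ v i)) ⟩
      ∑V (λ i → ∑V (λ j → c j ∙ (E i j ∙ v i)))    ≈⟨ ∑V-cong (λ i → ∑V-cong (λ j → reassociate (c j) (E i j) _)) ⟩
      ∑V (λ i → ∑V (λ j → (E i j * c j) ∙ v i))    ≈⟨ ∑V-cong (λ i → ∑-∙ (λ j → E i j * c j) (v i)) ⟨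
      ∑V (λ i → ∑ (λ j → E i j * c j) ∙ v i)       ∎
      where
      reassociate : ∀ a b x → (a ∙ (b ∙ x)) ≋ ((b * a) ∙ x)
      reassociate a b x = ≋-trans (≋-sym (∙-assoc a b x)) (∙-cong (*-comm a b) ≋-refl)

    lc-⊕ : ∀ {k} (v w : Fin k → V) c → lc (λ i → v i ⊕ w i) c ≋ (lc v c ⊕ lc w c)
    lc-⊕ v w c = ≋-trans (∑V-cong (λ i → ∙-distribˡ (c i) (v i) (w i))) (∑V-⊕ (λ i → c i ∙ v i) (λ i → c i ∙ w i))

    lc-multiples : ∀ {k} (a : Fin k → Carrier) x c → lc (λ i → a i ∙ x) c ≋ (∑ (λ i → c i * a i) ∙ x)
    lc-multiples a x c = ≋-trans (∑V-cong (λ i → ≋-sym (∙-assoc (c i) (a i) x))) (≋-sym (∑-∙ (λ i → c i * a i) x))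

    lc-δ : ∀ {n} (v : Fin n → V) j → lc v (δ j) ≋ v j
    lc-δ v j =
      ≋-trans (∑V-single (λ i → Id i j ∙ v i) j (λ i i≢j → ≋-trans (∙-cong (Id-off i j i≢j) ≋-refl) (∙-zeroˡ _)))
                       (≋-trans (∙-cong (Id-diag j) ≋-refl) (∙-identity _))

    lc-injective : ∀ {k} (v : Fin k → V) → LinIndep v → ∀ c d → lc v c ≋ lc v d → ∀ i → c i ≈ d i
    lc-injective v v-indep c d c≋d i = x+-1*y≈0⇒x≈y (v-indep (λ i → c i + (- 1#) * d i) difference≋𝟎 i)
      where
      difference≋𝟎 : lc v (λ i → c i + (- 1#) * d i) ≋ 𝟎
      difference≋𝟎 = begin
        lc v (λ i → c i + (- 1#) * d i)   ≈⟨ lc-sub v c d ⟩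
        lc v c ⊕ ((- 1#) ∙ lc v d)        ≈⟨ ⊕-cong c≋d ≋-refl ⟩
        lc v d ⊕ ((- 1#) ∙ lc v d)        ≈⟨ ⊕-inverse _ ⟩
        𝟎                                 ∎

    lc-agree : ∀ {n} j (v w : Fin n → V) c → (∀ k → toℕ k < j → v k ≡ w k) → SupportedBelow j c → lc v c ≋ lc w c
    lc-agree j v w c v≡w c↓ = ∑V-cong term≋
      where
      term≋ : ∀ i → (c i ∙ v i) ≋ (c i ∙ w i)
      term≋ i with toℕ i ℕ.<? j
      ... | yes i<j = ≡.subst (λ z → (c i ∙ v i) ≋ (c i ∙ z)) (v≡w i i<j) ≋-refl
      ... | no i≮j = ≋-trans (cᵢ∙≋𝟎 (v i)) (≋-sym (cᵢ∙≋𝟎 (w i)))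
        where
        cᵢ∙≋𝟎 : ∀ x → (c i ∙ x) ≋ 𝟎
        cᵢ∙≋𝟎 x = ≋-trans (∙-cong (c↓ i (ℕₚ.≮⇒≥ i≮j)) ≋-refl) (∙-zeroˡ x)

    vecMat : ∀ {n} → (Fin n → V) → Mat n → Fin n → V
    vecMat v A j = lc v (λ i → A i j)

    vecMat-⊛ : ∀ {n} (v : Fin n → V) (A B : Mat n) j → vecMat v (A ⊛ B) j ≋ vecMat (vecMat v A) B j
    vecMat-⊛ v A B j = ≋-sym (lc-lc v A (λ k → B k j))

    InSpan-resp : ∀ {k} (v : Fin k → V) {x y} → x ≋ y → InSpan v x → InSpan v y
    InSpan-resp v x≋y (c , x≋lc) = c , ≋-trans (≋-sym x≋y) x≋lc

    InSpan-lc : ∀ {k} (v : Fin k → V) c → InSpan v (lc v c)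
    InSpan-lc v c = c , ≋-refl

    InSpan-self : ∀ {k} (v : Fin k → V) j → InSpan v (v j)
    InSpan-self v j = InSpan-resp v (lc-δ v j) (InSpan-lc v (δ j))

    InSpan-𝟎 : ∀ {k} (v : Fin k → V) → InSpan v 𝟎
    InSpan-𝟎 v = InSpan-resp v (lc-zero v (λ _ → 0#) (λ _ → refl)) (InSpan-lc v (λ _ → 0#))

    InSpan-⊕ : ∀ {k} (v : Fin k → V) {x y} → InSpan v x → InSpan v y → InSpan v (x ⊕ y)
    InSpan-⊕ v (c , x≋) (d , y≋) = (λ i → c i + d i) , ≋-trans (⊕-cong x≋ y≋) (≋-sym (lc-+ v c d))

    InSpan-∙ : ∀ {k} (v : Fin k → V) a {x} → InSpan v x → InSpan v (a ∙ x)
    InSpan-∙ v a (c , x≋) = (λ i → a * c i) , ≋-trans (∙-cong refl x≋) (≋-sym (lc-* v a c))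

    InSpan-∑V : ∀ {k l} (v : Fin k → V) (f : Fin l → V) → (∀ i → InSpan v (f i)) → InSpan v (∑V f)
    InSpan-∑V {l = zero} v f f∈ = InSpan-𝟎 v
    InSpan-∑V {l = suc l} v f f∈ = InSpan-⊕ v (f∈ zero) (InSpan-∑V v (λ i → f (suc i)) (λ i → f∈ (suc i)))

    InSpan-lc-nonzero : ∀ {k l} (v : Fin k → V) (u : Fin l → V) (c : Fin l → Carrier) →
      (∀ t → c t ≈ 0# ⊎ InSpan v (u t)) → InSpan v (lc u c)
    InSpan-lc-nonzero v u c c≈0⊎u∈ = InSpan-∑V v (λ t → c t ∙ u t) term∈
      where
      term∈ : ∀ t → InSpan v (c t ∙ u t)
      term∈ t with c≈0⊎u∈ t
      ... | inj₁ c≈0 = InSpan-resp v (≋-sym (≋-trans (∙-cong c≈0 ≋-refl) (∙-zeroˡ (u t)))) (InSpan-𝟎 v)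
      ... | inj₂ u∈ = InSpan-∙ v (c t) u∈

    InSpan-lc-closed : ∀ {k l} (v : Fin k → V) (u : Fin l → V) c → (∀ t → InSpan v (u t)) → InSpan v (lc u c)
    InSpan-lc-closed v u c u∈ = InSpan-lc-nonzero v u c (λ t → inj₂ (u∈ t))

    InSpan-trans : ∀ {k l} (v : Fin k → V) (w : Fin l → V) {x} → InSpan w x → (∀ j → InSpan v (w j)) → InSpan v x
    InSpan-trans v w (c , x≋) w∈ = InSpan-resp v (≋-sym x≋) (InSpan-lc-closed v w c w∈)

    Free : ∀ {k} → (Fin k → V) → Set
    Free {zero} u = ⊤
    Free {suc k} u = (¬ InSpan (λ i → u (suc i)) (u zero)) × Free (λ i → u (suc i))

    Free⇒LinIndep : ∀ {k} (u : Fin k → V) → Free u → LinIndep u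
    Free⇒LinIndep {suc k} u (u₀∉ , rest-free) c lc≋𝟎 with c zero ≟ 0#
    ... | yes c₀≈0 = λ { zero → c₀≈0 ; (suc i) → rest-zero i }
      where
      rest-zero = Free⇒LinIndep (λ i → u (suc i)) rest-free (λ i → c (suc i))
        (≋-trans (≋-sym (⊕-identityˡ _))
          (≋-trans (⊕-cong (≋-sym (≋-trans (∙-cong c₀≈0 ≋-refl) (∙-zeroˡ (u zero)))) ≋-refl) lc≋𝟎))
    ... | no c₀≉0 = ⊥-elim (u₀∉ ((λ i → (c₀⁻¹ * (- 1#)) * c (suc i)) , u₀≋))
      where
      c₀⁻¹ = inv (c zero) c₀≉0
      rest = lc (λ i → u (suc i)) (λ i → c (suc i))
      u₀≋ : u zero ≋ lc (λ i → u (suc i)) (λ i → (c₀⁻¹ * (- 1#)) * c (suc i))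
      u₀≋ = begin
        u zero                      ≈⟨ ∙-identity _ ⟨
        1# ∙ u zero                 ≈⟨ ∙-cong (*-inverseˡ (c zero) c₀≉0) ≋-refl ⟨
        (c₀⁻¹ * c zero) ∙ u zero    ≈⟨ ∙-assoc _ _ _ ⟩
        c₀⁻¹ ∙ (c zero ∙ u zero)    ≈⟨ ∙-cong refl (x⊕y≋𝟎⇒x≋-1∙y _ _ lc≋𝟎) ⟩
        c₀⁻¹ ∙ ((- 1#) ∙ rest)      ≈⟨ ∙-assoc _ _ _ ⟨
        (c₀⁻¹ * (- 1#)) ∙ rest      ≈⟨ lc-* (λ i → u (suc i)) (c₀⁻¹ * (- 1#)) (λ i → c (suc i)) ⟨
        lc (λ i → u (suc i)) (λ i → (c₀⁻¹ * (- 1#)) * c (suc i)) ∎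

    lc-first : ∀ {i n} (i≤n : i ≤ n) (v : Fin n → V) (c : Fin i → Carrier) →
      lc (first i i≤n v) c ≋ lc v (pad i≤n c)
    lc-first {zero} i≤n v c = ≋-sym (lc-zero v (pad i≤n c) (λ _ → refl))
    lc-first {suc i} {suc n} i≤n v c =
      ⊕-cong ≋-refl (lc-first (ℕ.s≤s⁻¹ i≤n) (λ j → v (suc j)) (λ k → c (suc k)))

    InSpan-first⇒ : ∀ {i n} (i≤n : i ≤ n) (v : Fin n → V) {x} → InSpan (first i i≤n v) x →
      Σ (Fin n → Carrier) λ c → (x ≋ lc v c) × SupportedBelow i c
    InSpan-first⇒ i≤n v (c , x≋) = pad i≤n c , ≋-trans x≋ (lc-first i≤n v c) , pad-supportedBelow i≤n c

    InSpan-first⇐ : ∀ {i n} (i≤n : i ≤ n) (v : Fin n → V) {x} (c : Fin n → Carrier) →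
      x ≋ lc v c → SupportedBelow i c → InSpan (first i i≤n v) x
    InSpan-first⇐ {i} i≤n v {x} c x≋ c↓ = (λ k → c (inject≤ k i≤n)) , (begin
      x                                       ≈⟨ x≋ ⟩
      lc v c                                  ≈⟨ lc-congʳ v (λ j → pad-restrict i≤n c c↓ j) ⟨
      lc v (pad i≤n (λ k → c (inject≤ k i≤n))) ≈⟨ lc-first i≤n v _ ⟨
      lc (first i i≤n v) (λ k → c (inject≤ k i≤n)) ∎)

  Scalars : VSpace
  Scalars = record { V = Carrier ; _≋_ = _≈_ ; _⊕_ = _+_ ; 𝟎 = 0# ; _∙_ = _*_ }

  scalarLaws : VectorSpaceLaws Scalars
  scalarLaws = record
    { ≋-refl = refl ; ≋-sym = sym ; ≋-trans = trans ; ⊕-cong = +-cong ; ∙-cong = *-cong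
    ; ⊕-assoc = +-assoc ; ⊕-comm = +-comm ; ⊕-identityˡ = +-identityˡ
    ; ∙-distribˡ = distribˡ ; ∙-distribʳ = λ a b x → distribʳ x a b ; ∙-assoc = *-assoc
    ; ∙-identity = *-identityˡ ; ∙-zeroˡ = zeroˡ ; ∙-zeroʳ = zeroʳ }

  columnLaws : ∀ n → VectorSpaceLaws (Col n)
  columnLaws n = record
    { ≋-refl = λ i → refl ; ≋-sym = λ x≋y i → sym (x≋y i) ; ≋-trans = λ x≋y y≋z i → trans (x≋y i) (y≋z i)
    ; ⊕-cong = λ x≋y u≋v i → +-cong (x≋y i) (u≋v i) ; ∙-cong = λ a≈b x≋y i → *-cong a≈b (x≋y i)
    ; ⊕-assoc = λ x y z i → +-assoc (x i) (y i) (z i) ; ⊕-comm = λ x y i → +-comm (x i) (y i)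
    ; ⊕-identityˡ = λ x i → +-identityˡ (x i)
    ; ∙-distribˡ = λ a x y i → distribˡ a (x i) (y i) ; ∙-distribʳ = λ a b x i → distribʳ (x i) a b
    ; ∙-assoc = λ a b x i → *-assoc a b (x i)
    ; ∙-identity = λ x i → *-identityˡ (x i) ; ∙-zeroˡ = λ x i → zeroˡ (x i) ; ∙-zeroʳ = λ a i → zeroʳ a }

  smLaws : ∀ m → VectorSpaceLaws (SmSpace m)
  smLaws m = record
    { ≋-refl = λ k j → refl ; ≋-sym = λ x≋y k j → sym (x≋y k j)
    ; ≋-trans = λ x≋y y≋z k j → trans (x≋y k j) (y≋z k j)
    ; ⊕-cong = λ x≋y u≋v k j → +-cong (x≋y k j) (u≋v k j) ; ∙-cong = λ a≈b x≋y k j → *-cong a≈b (x≋y k j)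
    ; ⊕-assoc = λ x y z k j → +-assoc (coeff x k j) (coeff y k j) (coeff z k j)
    ; ⊕-comm = λ x y k j → +-comm (coeff x k j) (coeff y k j)
    ; ⊕-identityˡ = λ x k j → +-identityˡ (coeff x k j)
    ; ∙-distribˡ = λ a x y k j → distribˡ a (coeff x k j) (coeff y k j)
    ; ∙-distribʳ = λ a b x k j → distribʳ (coeff x k j) a b
    ; ∙-assoc = λ a b x k j → *-assoc a b (coeff x k j)
    ; ∙-identity = λ x k j → *-identityˡ (coeff x k j) ; ∙-zeroˡ = λ x k j → zeroˡ (coeff x k j)
    ; ∙-zeroʳ = λ a k j → zeroʳ a }

  module ScalarAlgebra = LinearAlgebra Scalars scalarLaws
  module ColumnAlgebra (n : ℕ) = LinearAlgebra (Col n) (columnLaws n)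

  x+ay≈0⇒y≈-a⁻¹x : ∀ x a y (a≉0 : ¬ a ≈ 0#) → x + a * y ≈ 0# → y ≈ ((- 1#) * inv a a≉0) * x
  x+ay≈0⇒y≈-a⁻¹x x a y a≉0 x+ay≈0 = begin
    y                              ≈⟨ *-identityˡ y ⟨
    1# * y                         ≈⟨ *-congʳ (*-inverseˡ a a≉0) ⟨
    (inv a a≉0 * a) * y            ≈⟨ *-assoc _ _ _ ⟩
    inv a a≉0 * (a * y)            ≈⟨ *-congˡ (ScalarAlgebra.x⊕y≋𝟎⇒x≋-1∙y (a * y) x (trans (+-comm _ _) x+ay≈0)) ⟩
    inv a a≉0 * ((- 1#) * x)       ≈⟨ *-left-comm _ _ _ ⟩
    (- 1#) * (inv a a≉0 * x)       ≈⟨ *-assoc _ _ _ ⟨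
    ((- 1#) * inv a a≉0) * x       ∎
    where open ≈-Reasoning

  ∑V-scalar : ∀ {k} (f : Fin k → Carrier) → LinAlg.∑V Scalars f ≡ ∑ f
  ∑V-scalar {zero} f = ≡.refl
  ∑V-scalar {suc k} f = ≡.cong (f zero +_) (∑V-scalar (λ i → f (suc i)))

  ∑V-column : ∀ {n k} (f : Fin k → Fin n → Carrier) i → LinAlg.∑V (Col n) f i ≡ ∑ (λ t → f t i)
  ∑V-column {k = zero} f i = ≡.refl
  ∑V-column {k = suc k} f i = ≡.cong (f zero i +_) (∑V-column (λ t → f (suc t)) i)

  ∑V-coeff : ∀ {m k} (f : Fin k → Sm m) a j → coeff (LinAlg.∑V (SmSpace m) f) a j ≡ ∑ (λ i → coeff (f i) a j)
  ∑V-coeff {k = zero} f a j = ≡.refl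
  ∑V-coeff {k = suc k} f a j = ≡.cong (coeff (f zero) a j +_) (∑V-coeff (λ i → f (suc i)) a j)

  ≡⇒≈ : ∀ {a b} → a ≡ b → a ≈ b
  ≡⇒≈ ≡.refl = refl

  lc-column : ∀ {n k} (u : Fin k → Fin n → Carrier) c i → ColumnAlgebra.lc n u c i ≈ ∑ (λ t → c t * u t i)
  lc-column u c i = ≡⇒≈ (∑V-column (λ t i → c t * u t i) i)

  ∑-cong : ∀ {k} {f g : Fin k → Carrier} → (∀ i → f i ≈ g i) → ∑ f ≈ ∑ g
  ∑-cong {zero} f≈g = refl
  ∑-cong {suc k} f≈g = +-cong (f≈g zero) (∑-cong (λ i → f≈g (suc i)))

  ∑-+ : ∀ {k} (f g : Fin k → Carrier) → ∑ (λ i → f i + g i) ≈ ∑ f + ∑ g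
  ∑-+ f g = ≡.subst₂ _≈_ (∑V-scalar (λ i → f i + g i)) (≡.cong₂ _+_ (∑V-scalar f) (∑V-scalar g))
                     (ScalarAlgebra.∑V-⊕ f g)

  ∑-*ˡ : ∀ {k} a (f : Fin k → Carrier) → a * ∑ f ≈ ∑ (λ i → a * f i)
  ∑-*ˡ a f = ≡.subst₂ _≈_ (≡.cong (a *_) (∑V-scalar f)) (∑V-scalar (λ i → a * f i)) (ScalarAlgebra.∑V-∙ a f)

  ∑-*ʳ : ∀ {k} a (f : Fin k → Carrier) → ∑ f * a ≈ ∑ (λ i → f i * a)
  ∑-*ʳ a f = trans (*-comm _ _) (trans (∑-*ˡ a f) (∑-cong (λ i → *-comm a (f i))))

  ∑-zero : ∀ {k} (f : Fin k → Carrier) → (∀ i → f i ≈ 0#) → ∑ f ≈ 0#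
  ∑-zero f f≈0 = ≡.subst (_≈ 0#) (∑V-scalar f) (ScalarAlgebra.∑V-𝟎 f f≈0)

  ∑-swap : ∀ {k l} (f : Fin k → Fin l → Carrier) → ∑ (λ i → ∑ (λ j → f i j)) ≈ ∑ (λ j → ∑ (λ i → f i j))
  ∑-swap {zero} {l} f = sym (∑-zero {l} (λ j → 0#) (λ _ → refl))
  ∑-swap {suc k} f = trans (+-congˡ (∑-swap (λ i → f (suc i))))
                           (sym (∑-+ (λ j → f zero j) (λ j → ∑ (λ i → f (suc i) j))))

  ∑-single : ∀ {k} (f : Fin k → Carrier) (j : Fin k) → (∀ i → i ≢ j → f i ≈ 0#) → ∑ f ≈ f j
  ∑-single f j f≈0 = ≡.subst (_≈ f j) (∑V-scalar f) (ScalarAlgebra.∑V-single f j f≈0)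

  ≈M-refl : ∀ {n} {A : Mat n} → A ≈M A
  ≈M-refl i j = refl

  ≈M-sym : ∀ {n} {A B : Mat n} → A ≈M B → B ≈M A
  ≈M-sym A≈B i j = sym (A≈B i j)

  ≈M-trans : ∀ {n} {A B C : Mat n} → A ≈M B → B ≈M C → A ≈M C
  ≈M-trans A≈B B≈C i j = trans (A≈B i j) (B≈C i j)

  ⊛-cong : ∀ {n} {A A′ B B′ : Mat n} → A ≈M A′ → B ≈M B′ → (A ⊛ B) ≈M (A′ ⊛ B′)
  ⊛-cong A≈ B≈ i j = ∑-cong (λ k → *-cong (A≈ i k) (B≈ k j))

  ⊛-assoc : ∀ {n} (A B C : Mat n) → ((A ⊛ B) ⊛ C) ≈M (A ⊛ (B ⊛ C))
  ⊛-assoc A B C i j = begin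
    ∑ (λ k → ∑ (λ l → A i l * B l k) * C k j)     ≈⟨ ∑-cong (λ k → ∑-*ʳ (C k j) (λ l → A i l * B l k)) ⟩
    ∑ (λ k → ∑ (λ l → A i l * B l k * C k j))     ≈⟨ ∑-swap (λ k l → A i l * B l k * C k j) ⟩
    ∑ (λ l → ∑ (λ k → A i l * B l k * C k j))     ≈⟨ ∑-cong (λ l → ∑-cong (λ k → *-assoc (A i l) (B l k) (C k j))) ⟩
    ∑ (λ l → ∑ (λ k → A i l * (B l k * C k j)))   ≈⟨ ∑-cong (λ l → ∑-*ˡ (A i l) (λ k → B l k * C k j)) ⟨
    ∑ (λ l → A i l * ∑ (λ k → B l k * C k j))     ∎
    where open ≈-Reasoning

  ⊛-identityˡ : ∀ {n} (A : Mat n) → (Id ⊛ A) ≈M A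
  ⊛-identityˡ A i j =
    trans (∑-single (λ k → Id i k * A k j) i (λ k k≢i → trans (*-congʳ (Id-off i k (λ e → k≢i (≡.sym e)))) (zeroˡ _)))
          (trans (*-congʳ (Id-diag i)) (*-identityˡ _))

  ⊛-identityʳ : ∀ {n} (A : Mat n) → (A ⊛ Id) ≈M A
  ⊛-identityʳ A i j =
    trans (∑-single (λ k → A i k * Id k j) j (λ k k≢j → trans (*-congˡ (Id-off k j k≢j)) (zeroʳ _)))
          (trans (*-congˡ (Id-diag j)) (*-identityʳ _))

  matVec : ∀ {n} → Mat n → (Fin n → Carrier) → Fin n → Carrier
  matVec A c i = ∑ (λ j → A i j * c j)

  matVec-cong : ∀ {n} {A B : Mat n} {c d : Fin n → Carrier} → A ≈M B → (∀ i → c i ≈ d i) →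
    ∀ i → matVec A c i ≈ matVec B d i
  matVec-cong A≈B c≈d i = ∑-cong (λ j → *-cong (A≈B i j) (c≈d j))

  matVec-congʳ : ∀ {n} (A : Mat n) {c d : Fin n → Carrier} → (∀ i → c i ≈ d i) → ∀ i → matVec A c i ≈ matVec A d i
  matVec-congʳ A = matVec-cong ≈M-refl

  matVec-⊛ : ∀ {n} (A B : Mat n) (c : Fin n → Carrier) i → matVec (A ⊛ B) c i ≈ matVec A (matVec B c) i
  matVec-⊛ A B c i = begin
    ∑ (λ j → ∑ (λ k → A i k * B k j) * c j)     ≈⟨ ∑-cong (λ j → ∑-*ʳ (c j) (λ k → A i k * B k j)) ⟩
    ∑ (λ j → ∑ (λ k → A i k * B k j * c j))     ≈⟨ ∑-swap (λ j k → A i k * B k j * c j) ⟩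
    ∑ (λ k → ∑ (λ j → A i k * B k j * c j))     ≈⟨ ∑-cong (λ k → ∑-cong (λ j → *-assoc (A i k) (B k j) (c j))) ⟩
    ∑ (λ k → ∑ (λ j → A i k * (B k j * c j)))   ≈⟨ ∑-cong (λ k → ∑-*ˡ (A i k) (λ j → B k j * c j)) ⟨
    ∑ (λ k → A i k * ∑ (λ j → B k j * c j))     ∎
    where open ≈-Reasoning

  matVec-Id : ∀ {n} (c : Fin n → Carrier) i → matVec Id c i ≈ c i
  matVec-Id c i =
    trans (∑-single (λ j → Id i j * c j) i (λ j j≢i → trans (*-congʳ (Id-off i j (λ e → j≢i (≡.sym e)))) (zeroˡ _)))
          (trans (*-congʳ (Id-diag i)) (*-identityˡ _))

  matVec-δ : ∀ {n} (A : Mat n) j i → matVec A (δ j) i ≈ A i j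
  matVec-δ A j i = ⊛-identityʳ A i j

  matVec-+ : ∀ {n} (A : Mat n) (c d : Fin n → Carrier) i → matVec A (λ j → c j + d j) i ≈ matVec A c i + matVec A d i
  matVec-+ A c d i = trans (∑-cong (λ j → distribˡ (A i j) (c j) (d j))) (∑-+ (λ j → A i j * c j) (λ j → A i j * d j))

  matVec-injective : ∀ {n} {P Q : Mat n} → (P ⊛ Q) ≈M Id → ∀ c d → (∀ i → matVec Q c i ≈ matVec Q d i) →
    ∀ i → c i ≈ d i
  matVec-injective {P = P} {Q} PQ≈Id c d Qc≈Qd i = begin
    c i                        ≈⟨ matVec-Id c i ⟨
    matVec Id c i              ≈⟨ matVec-cong (≈M-sym PQ≈Id) (λ _ → refl) i ⟩
    matVec (P ⊛ Q) c i         ≈⟨ matVec-⊛ P Q c i ⟩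
    matVec P (matVec Q c) i    ≈⟨ matVec-congʳ P Qc≈Qd i ⟩
    matVec P (matVec Q d) i    ≈⟨ matVec-⊛ P Q d i ⟨
    matVec (P ⊛ Q) d i         ≈⟨ matVec-cong PQ≈Id (λ _ → refl) i ⟩
    matVec Id d i              ≈⟨ matVec-Id d i ⟩
    d i                        ∎
    where open ≈-Reasoning

  erase : ∀ {n} → Fin n → (Fin n → Carrier) → Fin n → Carrier
  erase J c i = c i + (- 1#) * (c J * δ J i)

  erase-split : ∀ {n} (J : Fin n) c i → c i ≈ erase J c i + c J * δ J i
  erase-split J c i = sym (x+-1*y+y≈x (c i) (c J * δ J i))

  erase-supportedBelow : ∀ {n} {J : Fin n} {j c} → toℕ J ≡ j → SupportedBelow (suc j) c → SupportedBelow j (erase J c)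
  erase-supportedBelow {J = J} {j} {c} J≡j c↓ k j≤k with ℕₚ.m≤n⇒m<n∨m≡n j≤k
  ... | inj₁ j<k = trans (+-cong (c↓ k j<k) (*-congˡ (trans (*-congˡ δJₖ≈0) (zeroʳ _)))) (trans (+-identityˡ _) (zeroʳ _))
    where δJₖ≈0 = δ-supportedBelow J k (≡.subst (_< toℕ k) (≡.sym J≡j) j<k)
  ... | inj₂ j≡k with Finₚ.toℕ-injective (≡.trans J≡j j≡k)
  ...   | ≡.refl = trans (+-congˡ (*-congˡ (trans (*-congˡ (Id-diag J)) (*-identityʳ _)))) (x+-1*x≈0 (c J))

  SupportedBelow-suc : ∀ {n} {J : Fin n} {j c} → toℕ J ≡ j → SupportedBelow (suc j) c → c J ≈ 0# →
    SupportedBelow j c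
  SupportedBelow-suc {J = J} {j} {c} J≡j c↓ cJ≈0 k j≤k with ℕₚ.m≤n⇒m<n∨m≡n j≤k
  ... | inj₁ j<k = c↓ k j<k
  ... | inj₂ j≡k with Finₚ.toℕ-injective (≡.trans J≡j j≡k)
  ...   | ≡.refl = cJ≈0

  columns : ∀ {n} → Mat n → Fin n → Fin n → Carrier
  columns N j i = N i j

  matVec-columns : ∀ {n} (N : Mat n) c i → matVec N c i ≈ ColumnAlgebra.lc n (columns N) c i
  matVec-columns N c i = trans (∑-cong (λ j → *-comm (N i j) (c j))) (sym (lc-column (columns N) c i))

  matVec-* : ∀ {n} (A : Mat n) a (c : Fin n → Carrier) i → matVec A (λ j → a * c j) i ≈ a * matVec A c i
  matVec-* A a c i = trans (∑-cong (λ j → *-left-comm (A i j) a (c j))) (sym (∑-*ˡ a (λ j → A i j * c j)))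

  matVec-∑ : ∀ {n k} (A : Mat n) (a : Fin k → Carrier) (B : Fin k → Fin n → Carrier) i →
    matVec A (λ l → ∑ (λ t → a t * B t l)) i ≈ ∑ (λ t → a t * matVec A (B t) i)
  matVec-∑ A a B i = begin
    ∑ (λ l → A i l * ∑ (λ t → a t * B t l))       ≈⟨ ∑-cong (λ l → ∑-*ˡ (A i l) (λ t → a t * B t l)) ⟩
    ∑ (λ l → ∑ (λ t → A i l * (a t * B t l)))     ≈⟨ ∑-swap (λ l t → A i l * (a t * B t l)) ⟩
    ∑ (λ t → ∑ (λ l → A i l * (a t * B t l)))     ≈⟨ ∑-cong (λ t → ∑-cong (λ l → *-left-comm (A i l) (a t) (B t l))) ⟩
    ∑ (λ t → ∑ (λ l → a t * (A i l * B t l)))     ≈⟨ ∑-cong (λ t → ∑-*ˡ (a t) (λ l → A i l * B t l)) ⟨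
    ∑ (λ t → a t * matVec A (B t) i)              ∎
    where open ≈-Reasoning

  StrictlyUpper : ∀ {n} → Mat n → Set
  StrictlyUpper N = ∀ i j → toℕ j ≤ toℕ i → N i j ≈ 0#

  StrictlyUpper⇒UpperTriangular : ∀ {n} {N : Mat n} → StrictlyUpper N → UpperTriangular N
  StrictlyUpper⇒UpperTriangular N↗ i j j<i = N↗ i j (ℕₚ.<⇒≤ j<i)

  ^M-strictlyUpper : ∀ {n} (N : Mat n) → StrictlyUpper N → ∀ k i j → toℕ j < toℕ i ℕ.+ k → (N ^M k) i j ≈ 0#
  ^M-strictlyUpper N N↗ zero i j j<i+0 =
    Id-off i j (λ i≡j → ℕₚ.<⇒≢ j<i+0 (≡.trans (≡.cong toℕ (≡.sym i≡j)) (≡.sym (ℕₚ.+-identityʳ _))))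
  ^M-strictlyUpper N N↗ (suc k) i j j<i+k+1 = ∑-zero _ term≈0
    where
    term≈0 : ∀ l → N i l * (N ^M k) l j ≈ 0#
    term≈0 l with ℕₚ.≤-<-connex (toℕ l) (toℕ i)
    ... | inj₁ l≤i = trans (*-congʳ (N↗ i l l≤i)) (zeroˡ _)
    ... | inj₂ i<l = trans (*-congˡ (^M-strictlyUpper N N↗ k l j (ℕₚ.<-≤-trans j<i+k+1
            (ℕₚ.≤-trans (ℕₚ.≤-reflexive (ℕₚ.+-suc (toℕ i) k)) (ℕₚ.+-monoˡ-≤ k i<l))))) (zeroʳ _)

  StrictlyUpper⇒Nilpotent : ∀ {n} (N : Mat n) → StrictlyUpper N → Nilpotent N
  StrictlyUpper⇒Nilpotent {n} N N↗ =
    n , λ i j → ^M-strictlyUpper N N↗ n i j (ℕₚ.<-≤-trans (Finₚ.toℕ<n j) (ℕₚ.m≤n+m n (toℕ i)))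

  UpperTriangular-Id : ∀ {n} → UpperTriangular (Id {n})
  UpperTriangular-Id i j j<i = Id-off i j (λ i≡j → ℕₚ.<⇒≢ j<i (≡.cong toℕ (≡.sym i≡j)))

  UpperTriangular-⊛ : ∀ {n} {A B : Mat n} → UpperTriangular A → UpperTriangular B → UpperTriangular (A ⊛ B)
  UpperTriangular-⊛ {A = A} {B} A↗ B↗ i j j<i = ∑-zero _ term≈0
    where
    term≈0 : ∀ k → A i k * B k j ≈ 0#
    term≈0 k with ℕₚ.<-≤-connex (toℕ k) (toℕ i)
    ... | inj₁ k<i = trans (*-congʳ (A↗ i k k<i)) (zeroˡ _)
    ... | inj₂ i≤k = trans (*-congˡ (B↗ k j (ℕₚ.<-≤-trans j<i i≤k))) (zeroʳ _)

  ⊛-diagonal : ∀ {n} {A B : Mat n} → UpperTriangular A → UpperTriangular B → ∀ i → (A ⊛ B) i i ≈ A i i * B i i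
  ⊛-diagonal {A = A} {B} A↗ B↗ i = ∑-single (λ k → A i k * B k i) i term≈0
    where
    term≈0 : ∀ k → k ≢ i → A i k * B k i ≈ 0#
    term≈0 k k≢i with ℕₚ.<-cmp (toℕ k) (toℕ i)
    ... | tri< k<i _ _ = trans (*-congʳ (A↗ i k k<i)) (zeroˡ _)
    ... | tri≈ _ k≡i _ = ⊥-elim (k≢i (Finₚ.toℕ-injective k≡i))
    ... | tri> _ _ i<k = trans (*-congˡ (B↗ k i i<k)) (zeroʳ _)

  ^M-upperTriangular : ∀ {n} {N : Mat n} → UpperTriangular N → ∀ k → UpperTriangular (N ^M k)
  ^M-upperTriangular N↗ zero = UpperTriangular-Id
  ^M-upperTriangular N↗ (suc k) = UpperTriangular-⊛ N↗ (^M-upperTriangular N↗ k)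

  ^M-diagonal : ∀ {n} {N : Mat n} → UpperTriangular N → ∀ k i → (N ^M k) i i ≈ N i i ^ k
  ^M-diagonal N↗ zero i = Id-diag i
  ^M-diagonal N↗ (suc k) i =
    trans (⊛-diagonal N↗ (^M-upperTriangular N↗ k) i) (*-congˡ (^M-diagonal N↗ k i))

  ^-nilpotent⇒≈0 : ∀ a k → a ^ k ≈ 0# → a ≈ 0#
  ^-nilpotent⇒≈0 a zero 1≈0 = ⊥-elim (0≉1 (sym 1≈0))
  ^-nilpotent⇒≈0 a (suc k) a^k+1≈0 with a ≟ 0#
  ... | yes a≈0 = a≈0
  ... | no a≉0 = ^-nilpotent⇒≈0 a k (*-cancelˡ-0 a (a ^ k) a≉0 a^k+1≈0)

  -- (N ^ k) j j = N j j ^ k, and a nilpotent scalar vanishes.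
  Nilpotent∧UpperTriangular⇒StrictlyUpper : ∀ {n} {N : Mat n} → UpperTriangular N → Nilpotent N → StrictlyUpper N
  Nilpotent∧UpperTriangular⇒StrictlyUpper {N = N} N↗ (k , N^k≈0) i j j≤i with ℕₚ.m≤n⇒m<n∨m≡n j≤i
  ... | inj₁ j<i = N↗ i j j<i
  ... | inj₂ j≡i with Finₚ.toℕ-injective j≡i
  ...   | ≡.refl = ^-nilpotent⇒≈0 (N j j) k (trans (sym (^M-diagonal N↗ k j)) (N^k≈0 j j))

  Id-suc : ∀ {n} (a b : Fin n) → Id {suc n} (suc a) (suc b) ≈ Id a b
  Id-suc {n} a b = by-cases (a Fin.≟ b)
    where
    by-cases : Dec (a ≡ b) → Id {suc n} (suc a) (suc b) ≈ Id a b
    by-cases (yes ≡.refl) = trans (Id-diag (suc a)) (sym (Id-diag a))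
    by-cases (no a≢b) = trans (Id-off (suc a) (suc b) (λ e → a≢b (Finₚ.suc-injective e))) (sym (Id-off a b a≢b))

  -- X₀₀ B₀₀ = 1 kills the rest of the first column of X; then recurse on the lower-right minors.
  UpperTriangular-leftInverse : ∀ {n} {B X : Mat n} → UpperTriangular B → (X ⊛ B) ≈M Id → UpperTriangular X
  UpperTriangular-leftInverse {suc n} {B} {X} B↗ XB≈I (suc i) zero _ = begin
    X (suc i) zero                                 ≈⟨ *-identityʳ _ ⟨
    X (suc i) zero * 1#                            ≈⟨ *-congˡ X₀₀B₀₀≈1 ⟨
    X (suc i) zero * (X zero zero * B zero zero)   ≈⟨ *-left-comm _ _ _ ⟩
    X zero zero * (X (suc i) zero * B zero zero)   ≈⟨ *-congˡ Xᵢ₀B₀₀≈0 ⟩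
    X zero zero * 0#                               ≈⟨ zeroʳ _ ⟩
    0#                                             ∎
    where
    open ≈-Reasoning
    column₀ : ∀ a → (X ⊛ B) a zero ≈ X a zero * B zero zero
    column₀ a = trans (+-congˡ (∑-zero _ (λ k → trans (*-congˡ (B↗ (suc k) zero (s≤s z≤n))) (zeroʳ _))))
                      (+-identityʳ _)
    X₀₀B₀₀≈1 : X zero zero * B zero zero ≈ 1#
    X₀₀B₀₀≈1 = trans (sym (column₀ zero)) (trans (XB≈I zero zero) (Id-diag {suc n} zero))
    Xᵢ₀B₀₀≈0 : X (suc i) zero * B zero zero ≈ 0#
    Xᵢ₀B₀₀≈0 = trans (sym (column₀ (suc i))) (trans (XB≈I (suc i) zero) (Id-off (suc i) zero (λ ())))
  UpperTriangular-leftInverse {suc n} {B} {X} B↗ XB≈I (suc i) (suc j) (s≤s j<i) =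
    UpperTriangular-leftInverse {X = λ a b → X (suc a) (suc b)} (λ a b b<a → B↗ (suc a) (suc b) (s≤s b<a)) minor i j j<i
    where
    Xₐ₀≈0 : ∀ a → X (suc a) zero ≈ 0#
    Xₐ₀≈0 a = UpperTriangular-leftInverse {X = X} B↗ XB≈I (suc a) zero (s≤s z≤n)
    minor : ((λ a b → X (suc a) (suc b)) ⊛ (λ a b → B (suc a) (suc b))) ≈M Id
    minor a b = begin
      ∑ (λ k → X (suc a) (suc k) * B (suc k) (suc b))         ≈⟨ +-identityˡ _ ⟨
      0# + ∑ (λ k → X (suc a) (suc k) * B (suc k) (suc b))    ≈⟨ +-congʳ (trans (*-congʳ (Xₐ₀≈0 a)) (zeroˡ _)) ⟨
      (X ⊛ B) (suc a) (suc b)                                 ≈⟨ XB≈I (suc a) (suc b) ⟩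
      Id (suc a) (suc b)                                      ≈⟨ Id-suc a b ⟩
      Id a b                                                  ∎
      where open ≈-Reasoning

  matVec-supportedBelow : ∀ {n} {A : Mat n} → UpperTriangular A → ∀ i {c} → SupportedBelow i c →
    SupportedBelow i (matVec A c)
  matVec-supportedBelow {A = A} A↗ i {c} c↓ k i≤k = ∑-zero _ term≈0
    where
    term≈0 : ∀ j → A k j * c j ≈ 0#
    term≈0 j with ℕₚ.<-≤-connex (toℕ j) (toℕ k)
    ... | inj₁ j<k = trans (*-congʳ (A↗ k j j<k)) (zeroˡ _)
    ... | inj₂ k≤j = trans (*-congˡ (c↓ j (ℕₚ.≤-trans i≤k k≤j))) (zeroʳ _)

  matVec-strictlyUpper : ∀ {n} {N : Mat n} → StrictlyUpper N → ∀ j {c} → SupportedBelow (suc j) c →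
    SupportedBelow j (matVec N c)
  matVec-strictlyUpper {N = N} N↗ j {c} c↓ i j≤i = ∑-zero _ term≈0
    where
    term≈0 : ∀ l → N i l * c l ≈ 0#
    term≈0 l with ℕₚ.≤-<-connex (toℕ l) (toℕ i)
    ... | inj₁ l≤i = trans (*-congʳ (N↗ i l l≤i)) (zeroˡ _)
    ... | inj₂ i<l = trans (*-congˡ (c↓ l (ℕₚ.≤-trans (s≤s j≤i) i<l))) (zeroʳ _)

  matVec-erase : ∀ {n} (N : Mat n) J c i → matVec N (erase J c) i + c J * N i J ≈ matVec N c i
  matVec-erase N J c i = begin
    matVec N (erase J c) i + c J * N i J                    ≈⟨ +-congˡ (*-congˡ (matVec-δ N J i)) ⟨
    matVec N (erase J c) i + c J * matVec N (δ J) i         ≈⟨ +-congˡ (matVec-* N (c J) (δ J) i) ⟨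
    matVec N (erase J c) i + matVec N (λ k → c J * δ J k) i ≈⟨ matVec-+ N (erase J c) (λ k → c J * δ J k) i ⟨
    matVec N (λ k → erase J c k + c J * δ J k) i           ≈⟨ matVec-congʳ N (erase-split J c) i ⟨
    matVec N c i                                           ∎
    where open ≈-Reasoning

  Conj-refl : ∀ {n} (N : Mat n) → Conj N N
  Conj-refl N = Id , Id , UpperTriangular-Id , ⊛-identityˡ Id , ⊛-identityˡ Id
              , ≈M-sym (≈M-trans (⊛-identityʳ (Id ⊛ N)) (⊛-identityˡ N))

  -- Gaussian elimination along a nonzero coordinate i₀ of u₀, followed by deleting that coordinate
  steinitz-columns : ∀ p k (u : Fin k → Fin p → Carrier) → LinAlg.LinIndep (Col p) u → k ≤ p
  steinitz-columns p zero u _ = z≤n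
  steinitz-columns zero (suc k) u u-indep = ⊥-elim (0≉1 (sym (u-indep (λ _ → 1#) (λ ()) zero)))
  steinitz-columns (suc p) (suc k) u u-indep with Finₚ.any? (λ i → ¬? (u zero i ≟ 0#))
  ... | no u₀≈0 = ⊥-elim (0≉1 (trans (sym (u-indep (δ zero) lc≋𝟎 zero)) (Id-diag {suc k} zero)))
    where
    open ColumnAlgebra (suc p)
    lc≋𝟎 : lc u (δ zero) ≋ 𝟎
    lc≋𝟎 = ≋-trans (lc-δ u zero) λ i → decidable-stable (u zero i ≟ 0#) (λ u₀ᵢ≉0 → u₀≈0 (i , u₀ᵢ≉0))
  ... | yes (i₀ , a≉0) = s≤s (steinitz-columns p k u′ u′-indep)
    where
    open ColumnAlgebra (suc p)
    a = u zero i₀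
    μ : Fin k → Carrier
    μ s = (- 1#) * (u (suc s) i₀ * inv a a≉0)
    w : Fin k → Fin (suc p) → Carrier
    w s = u (suc s) ⊕ (μ s ∙ u zero)
    u′ : Fin k → Fin p → Carrier
    u′ s i = w s (Fin.punchIn i₀ i)
    w-pivot : ∀ s → w s i₀ ≈ 0#
    w-pivot s = trans (+-congˡ μa≈-b) (x+-1*x≈0 (u (suc s) i₀))
      where
      μa≈-b : μ s * a ≈ (- 1#) * u (suc s) i₀
      μa≈-b = trans (*-assoc _ _ _) (*-congˡ (trans (*-assoc _ _ _)
                (trans (*-congˡ (*-inverseˡ a a≉0)) (*-identityʳ _))))
    u′-indep : LinAlg.LinIndep (Col p) u′
    u′-indep c lc′≋𝟎 s = u-indep (∑ (λ s → c s * μ s) ∷ c) lcu≋𝟎 (suc s)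
      where
      lcw≋𝟎 : lc w c ≋ 𝟎
      lcw≋𝟎 i with i Fin.≟ i₀
      ... | yes ≡.refl = trans (lc-column w c i) (∑-zero _ (λ s → trans (*-congˡ (w-pivot s)) (zeroʳ _)))
      ... | no i≢i₀ = ≡.subst (λ i → lc w c i ≈ 0#) (Finₚ.punchIn-punchOut (λ e → i≢i₀ (≡.sym e)))
                        (trans (lc-column w c _) (trans (sym (lc-column u′ c _)) (lc′≋𝟎 _)))
      lcu≋𝟎 : lc u (∑ (λ s → c s * μ s) ∷ c) ≋ 𝟎
      lcu≋𝟎 = begin
        (∑ (λ s → c s * μ s) ∙ u zero) ⊕ lc (λ s → u (suc s)) c  ≈⟨ ⊕-comm _ _ ⟩
        lc (λ s → u (suc s)) c ⊕ (∑ (λ s → c s * μ s) ∙ u zero)  ≈⟨ ⊕-cong ≋-refl (lc-multiples μ (u zero) c) ⟨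
        lc (λ s → u (suc s)) c ⊕ lc (λ s → μ s ∙ u zero) c       ≈⟨ lc-⊕ _ _ c ⟨
        lc w c                                                   ≈⟨ lcw≋𝟎 ⟩
        𝟎                                                        ∎
        where open ≋-Reasoning

  module Dimension (W : VSpace) (L : VectorSpaceLaws W) where
    open LinearAlgebra W L
    open ≋-Reasoning

    steinitz : ∀ {k p} (u : Fin k → V) (v : Fin p → V) → LinIndep u → (∀ t → InSpan v (u t)) → k ≤ p
    steinitz {k} {p} u v u-indep u∈ = steinitz-columns p k E E-indep
      where
      E : Fin k → Fin p → Carrier
      E t = proj₁ (u∈ t)
      E-indep : LinAlg.LinIndep (Col p) E
      E-indep c lcE≋𝟎 = u-indep c (begin
        lc u c                                 ≈⟨ lc-cong (λ t → proj₂ (u∈ t)) (λ _ → refl) ⟩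
        lc (λ t → lc v (E t)) c                ≈⟨ lc-lc v (λ s t → E t s) c ⟩
        lc v (λ s → ∑ (λ t → E t s * c t))     ≈⟨ lc-zero v _ (λ s → trans (∑-cong (λ t → *-comm (E t s) (c t)))
                                                    (trans (sym (lc-column E c s)) (lcE≋𝟎 s))) ⟩
        𝟎                                      ∎)

  module ColumnEchelon {n : ℕ} (N : Mat n) where
    module Cols = ColumnAlgebra n

    -- column J of N is dependent when N e_J ∈ N (span (e_0, …, e_{J-1}))
    IsDependentVia : Fin n → (Fin n → Carrier) → Set
    IsDependentVia J b = SupportedBelow (toℕ J) b × (∀ i → N i J ≈ matVec N b i)

    Dependent : Fin n → Set
    Dependent J = Σ (Fin n → Carrier) (IsDependentVia J)

    dependent? : ∀ J → Dec (Dependent J)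
    dependent? J = ∃-vector? n (IsDependentVia J) resp (λ b → decide b)
      where
      resp : RespectsCoefficients (IsDependentVia J)
      resp c d c≈d (c↓ , Nc) = (λ k J≤k → trans (sym (c≈d k)) (c↓ k J≤k))
                             , (λ i → trans (Nc i) (matVec-congʳ N c≈d i))
      decide : ∀ b → Dec (IsDependentVia J b)
      decide b = Finₚ.all? (λ k → (toℕ J ℕ.≤? toℕ k) →-dec (b k ≟ 0#))
                 ×-dec Finₚ.all? (λ i → N i J ≟ matVec N b i)

    data ColumnKind (j : ℕ) : Set where
      beyond    : ¬ j < n → ColumnKind j
      pivot     : (j<n : j < n) → ¬ Dependent (fromℕ< j<n) → ColumnKind j
      dependent : (j<n : j < n) → Dependent (fromℕ< j<n) → ColumnKind j

    kind : ∀ j → ColumnKind j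
    kind j with j ℕ.<? n
    ... | no j≮n = beyond j≮n
    ... | yes j<n with dependent? (fromℕ< j<n)
    ...   | yes dep = dependent j<n dep
    ...   | no ¬dep = pivot j<n ¬dep

    Family : Set → Set
    Family A = Σ ℕ λ r → Fin r → A

    addPivot : ∀ j → ColumnKind j → Family (Fin n) → Family (Fin n)
    addPivot j (pivot j<n _) (r , P) = suc r , fromℕ< j<n ∷ P
    addPivot j _ P = P

    addDependent : ∀ j → ColumnKind j → Family (Σ (Fin n) Dependent) → Family (Σ (Fin n) Dependent)
    addDependent j (dependent j<n dep) (r , D) = suc r , (fromℕ< j<n , dep) ∷ D
    addDependent j _ D = D

    pivots : ℕ → Family (Fin n)
    pivots zero = 0 , λ ()
    pivots (suc j) = addPivot j (kind j) (pivots j)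

    dependents : ℕ → Family (Σ (Fin n) Dependent)
    dependents zero = 0 , λ ()
    dependents (suc j) = addDependent j (kind j) (dependents j)

    #pivots : ℕ → ℕ
    #pivots j = proj₁ (pivots j)

    #dependents : ℕ → ℕ
    #dependents j = proj₁ (dependents j)

    pivot-column : ∀ j → Fin (#pivots j) → Fin n
    pivot-column j = proj₂ (pivots j)

    dependent-column : ∀ j → Fin (#dependents j) → Σ (Fin n) Dependent
    dependent-column j = proj₂ (dependents j)

    #pivots+#dependents : ∀ j → j ≤ n → #pivots j ℕ.+ #dependents j ≡ j
    #pivots+#dependents zero _ = ≡.refl
    #pivots+#dependents (suc j) j<n with kind j
    ... | beyond j≮n = ⊥-elim (j≮n j<n)
    ... | pivot _ _ = ≡.cong suc (#pivots+#dependents j (ℕₚ.<⇒≤ j<n))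
    ... | dependent _ _ = ≡.trans (ℕₚ.+-suc (#pivots j) (#dependents j)) (≡.cong suc (#pivots+#dependents j (ℕₚ.<⇒≤ j<n)))

    pivot-column< : ∀ j t → toℕ (pivot-column j t) < j
    pivot-column< (suc j) t with kind j
    pivot-column< (suc j) t | beyond _ = ℕₚ.m<n⇒m<1+n (pivot-column< j t)
    pivot-column< (suc j) t | dependent _ _ = ℕₚ.m<n⇒m<1+n (pivot-column< j t)
    pivot-column< (suc j) zero | pivot j<n _ = ℕₚ.≤-reflexive (≡.cong suc (Finₚ.toℕ-fromℕ< j<n))
    pivot-column< (suc j) (suc t) | pivot _ _ = ℕₚ.m<n⇒m<1+n (pivot-column< j t)

    dependent-column< : ∀ j t → toℕ (proj₁ (dependent-column j t)) < j
    dependent-column< (suc j) t with kind j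
    dependent-column< (suc j) t | beyond _ = ℕₚ.m<n⇒m<1+n (dependent-column< j t)
    dependent-column< (suc j) t | pivot _ _ = ℕₚ.m<n⇒m<1+n (dependent-column< j t)
    dependent-column< (suc j) zero | dependent j<n _ = ℕₚ.≤-reflexive (≡.cong suc (Finₚ.toℕ-fromℕ< j<n))
    dependent-column< (suc j) (suc t) | dependent _ _ = ℕₚ.m<n⇒m<1+n (dependent-column< j t)

    #dependents-mono : ∀ {j k} → j ≤ k → #dependents j ≤ #dependents k
    #dependents-mono {j} {k} j≤k with ℕₚ.m≤n⇒m<n∨m≡n j≤k
    ... | inj₂ ≡.refl = ℕₚ.≤-refl
    ... | inj₁ (s≤s j≤k′) = ℕₚ.≤-trans (#dependents-mono j≤k′) (step _)
      where
      step : ∀ k → #dependents k ≤ #dependents (suc k)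
      step k with kind k
      ... | beyond _ = ℕₚ.≤-refl
      ... | pivot _ _ = ℕₚ.≤-refl
      ... | dependent _ _ = ℕₚ.n≤1+n _

    pivot-columns : ∀ j → Fin (#pivots j) → Fin n → Carrier
    pivot-columns j t = columns N (pivot-column j t)

    pivot-columns-free : ∀ j → Cols.Free (pivot-columns j)
    pivot-columns-free zero = tt
    pivot-columns-free (suc j) with kind j
    ... | beyond _ = pivot-columns-free j
    ... | dependent _ _ = pivot-columns-free j
    ... | pivot j<n ¬dep = column∉span , pivot-columns-free j
      where
      J = fromℕ< j<n
      column∉span : ¬ Cols.InSpan (pivot-columns j) (columns N J)
      column∉span (a , column≋) = ¬dep (b , b↓ , NJ≈Nb)
        where
        b : Fin n → Carrier
        b k = ∑ (λ t → a t * δ (pivot-column j t) k)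
        b↓ : SupportedBelow (toℕ J) b
        b↓ k J≤k = ∑-zero _ λ t → trans (*-congˡ (δ-supportedBelow (pivot-column j t) k
          (ℕₚ.<-≤-trans (pivot-column< j t) (≡.subst (_≤ toℕ k) (Finₚ.toℕ-fromℕ< j<n) J≤k)))) (zeroʳ _)
        NJ≈Nb : ∀ i → N i J ≈ matVec N b i
        NJ≈Nb i = begin
          N i J                                                  ≈⟨ column≋ i ⟩
          Cols.lc (pivot-columns j) a i                          ≈⟨ lc-column (pivot-columns j) a i ⟩
          ∑ (λ t → a t * N i (pivot-column j t))
                                                                 ≈⟨ ∑-cong (λ t → *-congˡ (matVec-δ N (pivot-column j t) i)) ⟨
          ∑ (λ t → a t * matVec N (δ (pivot-column j t)) i)      ≈⟨ matVec-∑ N a (λ t → δ (pivot-column j t)) i ⟨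
          matVec N b i                                           ∎
          where open ≈-Reasoning

    kernelVector : Σ (Fin n) Dependent → Fin n → Carrier
    kernelVector (J , b , _) i = δ J i + (- 1#) * b i

    matVec-kernelVector : ∀ d i → matVec N (kernelVector d) i ≈ 0#
    matVec-kernelVector (J , b , _ , NJ≈Nb) i = begin
      matVec N (λ k → δ J k + (- 1#) * b k) i               ≈⟨ matVec-+ N (δ J) (λ k → (- 1#) * b k) i ⟩
      matVec N (δ J) i + matVec N (λ k → (- 1#) * b k) i    ≈⟨ +-cong (matVec-δ N J i) (matVec-* N (- 1#) b i) ⟩
      N i J + (- 1#) * matVec N b i                         ≈⟨ +-congˡ (*-congˡ (NJ≈Nb i)) ⟨
      N i J + (- 1#) * N i J                                ≈⟨ x+-1*x≈0 (N i J) ⟩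
      0#                                                    ∎
      where open ≈-Reasoning

    kernelVector-pivot : ∀ d → kernelVector d (proj₁ d) ≈ 1#
    kernelVector-pivot (J , b , b↓ , _) =
      trans (+-congˡ (trans (*-congˡ (b↓ J ℕₚ.≤-refl)) (zeroʳ _))) (trans (+-identityʳ _) (Id-diag J))

    kernelVector-above : ∀ d k → toℕ (proj₁ d) < toℕ k → kernelVector d k ≈ 0#
    kernelVector-above (J , b , b↓ , _) k J<k =
      trans (+-cong (δ-supportedBelow J k J<k) (trans (*-congˡ (b↓ k (ℕₚ.<⇒≤ J<k))) (zeroʳ _))) (+-identityˡ 0#)

    toℕ≡⇒≡fromℕ< : ∀ (i : Fin n) {j} (j<n : j < n) → toℕ i ≡ j → i ≡ fromℕ< j<n
    toℕ≡⇒≡fromℕ< i j<n i≡j = Finₚ.toℕ-injective (≡.trans i≡j (≡.sym (Finₚ.toℕ-fromℕ< j<n)))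

    columns∈pivot-span : ∀ j → j ≤ n → ∀ i → toℕ i < j → Cols.InSpan (pivot-columns j) (columns N i)
    columns∈pivot-span (suc j) j<n i i<j+1 with kind j | ℕₚ.m≤n⇒m<n∨m≡n (ℕ.s≤s⁻¹ i<j+1)
    ... | beyond j≮n | _ = ⊥-elim (j≮n j<n)
    ... | pivot j<n′ _ | inj₁ i<j =
          Cols.InSpan-trans (columns N (fromℕ< j<n′) ∷ pivot-columns j) (pivot-columns j)
            (columns∈pivot-span j (ℕₚ.<⇒≤ j<n) i i<j)
            (λ t → Cols.InSpan-self (columns N (fromℕ< j<n′) ∷ pivot-columns j) (suc t))
    ... | pivot j<n′ _ | inj₂ i≡j rewrite toℕ≡⇒≡fromℕ< i j<n′ i≡j =
          Cols.InSpan-self (columns N (fromℕ< j<n′) ∷ pivot-columns j) zero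
    ... | dependent _ _ | inj₁ i<j = columns∈pivot-span j (ℕₚ.<⇒≤ j<n) i i<j
    ... | dependent j<n′ (b , b↓ , NJ≈Nb) | inj₂ i≡j rewrite toℕ≡⇒≡fromℕ< i j<n′ i≡j =
          Cols.InSpan-resp (pivot-columns j) {Cols.lc (columns N) b} (λ k → sym (trans (NJ≈Nb k) (matVec-columns N b k)))
            (Cols.InSpan-lc-nonzero (pivot-columns j) (columns N) b earlier∈)
      where
      earlier∈ : ∀ k → b k ≈ 0# ⊎ Cols.InSpan (pivot-columns j) (columns N k)
      earlier∈ k with toℕ k ℕ.<? j
      ... | yes k<j = inj₂ (columns∈pivot-span j (ℕₚ.<⇒≤ j<n) k k<j)
      ... | no k≮j = inj₁ (b↓ k (≡.subst (_≤ toℕ k) (≡.sym (Finₚ.toℕ-fromℕ< j<n′)) (ℕₚ.≮⇒≥ k≮j)))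

    rank-#pivots : Rank N (#pivots n)
    rank-#pivots = pivot-columns n
                 , Cols.Free⇒LinIndep (pivot-columns n) (pivot-columns-free n)
                 , (λ t → Cols.InSpan-self (columns N) (pivot-column n t))
                 , (λ i → columns∈pivot-span n ℕₚ.≤-refl i (Finₚ.toℕ<n i))

    rank≤#pivots : ∀ r → Rank N r → r ≤ #pivots n
    rank≤#pivots r (b , b-indep , b∈ , _) = Dimension.steinitz (Col n) (columnLaws n) b (pivot-columns n) b-indep
      (λ t → Cols.InSpan-trans (pivot-columns n) (columns N) (b∈ t)
               (λ i → columns∈pivot-span n ℕₚ.≤-refl i (Finₚ.toℕ<n i)))

  module TorsionFlags (m : ℕ) where
    open LinearAlgebra (SmSpace m) (smLaws m)
    open ≋-Reasoning

    TS-cong : ∀ {x y : Sm m} → x ≈S y → TS x ≈S TS y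
    TS-cong x≈y k j = x≈y (suc k) j

    TS-∑V : ∀ {k} (f : Fin k → Sm m) → TS (∑V f) ≈S ∑V (λ i → TS (f i))
    TS-∑V {zero} f k j = refl
    TS-∑V {suc k} f a j = +-congˡ (TS-∑V (λ i → f (suc i)) a j)

    TS-lc : ∀ {n} (ν : Fin n → Sm m) (N : Mat n) → MatrixOfT ν N → ∀ c → TS (lc ν c) ≈S lc ν (matVec N c)
    TS-lc ν N TνN c = begin
      TS (lc ν c)                ≈⟨ TS-∑V (λ i → c i ·S ν i) ⟩
      lc (λ i → TS (ν i)) c      ≈⟨ lc-cong TνN (λ _ → refl) ⟩
      lc (vecMat ν N) c          ≈⟨ lc-lc ν N c ⟩
      lc ν (matVec N c)          ∎

    ∈V-full⇐ : ∀ {n} (ν : Fin n → Sm m) {x} → InSpan ν x → x ∈V[ ν , full n ]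
    ∈V-full⇐ ν {x} (c , x≋) =
      InSpan-first⇐ ℕₚ.≤-refl ν {x} c x≋ (λ j n≤j → ⊥-elim (ℕₚ.<⇒≱ (Finₚ.toℕ<n j) n≤j))

    ∈V-full⇒ : ∀ {n} (ν : Fin n → Sm m) {x} → x ∈V[ ν , full n ] → InSpan ν x
    ∈V-full⇒ ν {x} x∈ = let c , x≋ , _ = InSpan-first⇒ ℕₚ.≤-refl ν {x} x∈ in c , x≋

    ν∈V[j+1] : ∀ {n} (ν : Fin n → Sm m) j → ν j ∈V[ ν , (suc (toℕ j) , Finₚ.toℕ<n j) ]
    ν∈V[j+1] ν j =
      InSpan-first⇐ (Finₚ.toℕ<n j) ν {ν j} (δ j) (≋-sym {lc ν (δ j)} {ν j} (lc-δ ν j)) (δ-supportedBelow j)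

    matrixOfT-column : ∀ {n} (ν : Fin n → Sm m) → IsTorsionFlagBasis ν → ∀ j →
      Σ (Fin n → Carrier) λ c → (TS (ν j) ≈S lc ν c) × SupportedBelow (toℕ j) c
    matrixOfT-column ν (_ , T-torsion) j =
      InSpan-first⇒ (ℕₚ.<⇒≤ (Finₚ.toℕ<n j)) ν {TS (ν j)} (T-torsion (toℕ j) (Finₚ.toℕ<n j) (ν j) (ν∈V[j+1] ν j))

    matrixOfT-exists : ∀ {n} (ν : Fin n → Sm m) → IsTorsionFlagBasis ν → Σ (Mat n) (MatrixOfT ν)
    matrixOfT-exists ν ν-flag = (λ i j → proj₁ (matrixOfT-column ν ν-flag j) i)
                              , (λ j → proj₁ (proj₂ (matrixOfT-column ν ν-flag j)))

    matrixOfT-strictlyUpper : ∀ {n} (ν : Fin n → Sm m) (N : Mat n) → IsTorsionFlagBasis ν → MatrixOfT ν N →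
      StrictlyUpper N
    matrixOfT-strictlyUpper ν N ν-flag TνN i j j≤i =
      trans (lc-injective ν (proj₁ ν-flag) (λ i → N i j) c same-combination i) (proj₂ (proj₂ column) i j≤i)
      where
      column = matrixOfT-column ν ν-flag j
      c = proj₁ column
      same-combination : lc ν (λ i → N i j) ≋ lc ν c
      same-combination = begin
        lc ν (λ i → N i j)   ≈⟨ TνN j ⟨
        TS (ν j)             ≈⟨ proj₁ (proj₂ column) ⟩
        lc ν c               ∎

    triangular-coordinates : ∀ {n} (μ x : Fin n → Sm m) → (∀ j → x j ∈V[ μ , (suc (toℕ j) , Finₚ.toℕ<n j) ]) →
      Σ (Mat n) λ A → UpperTriangular A × (∀ j → x j ≈S vecMat μ A j)
    triangular-coordinates μ x x∈ =
      (λ i j → proj₁ (column j) i) , (λ i j j<i → proj₂ (proj₂ (column j)) i j<i) , (λ j → proj₁ (proj₂ (column j)))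
      where
      column = λ j → InSpan-first⇒ (Finₚ.toℕ<n j) μ {x j} (x∈ j)

    module Isomorphism {n} {ν μ : Fin n → Sm m} (ν-flag : IsTorsionFlagBasis ν) (μ-flag : IsTorsionFlagBasis μ)
                       (iso : FlagIso ν μ) where
      open FlagIso iso

      ν∈Vₙ : ∀ j → ν j ∈V[ ν , full n ]
      ν∈Vₙ j = ∈V-full⇐ ν {ν j} (InSpan-self ν j)

      lc∈Vₙ : ∀ {k} (w : Fin k → Sm m) c → (∀ t → w t ∈V[ ν , full n ]) → lc w c ∈V[ ν , full n ]
      lc∈Vₙ w c = InSpan-lc-closed (first n ℕₚ.≤-refl ν) w c

      ι-𝟎 : ∀ p → ι 0S p ≈S 0S
      ι-𝟎 p = begin
        ι 0S p              ≈⟨ resp 0S (0# ·S 0S) p p₀ (λ _ _ → sym (zeroˡ 0#)) ⟩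
        ι (0# ·S 0S) p₀     ≈⟨ homogeneous 0# 0S p p₀ ⟩
        0# ·S ι 0S p        ≈⟨ ∙-zeroˡ (ι 0S p) ⟩
        0S                  ∎
        where p₀ = InSpan-∙ (first n ℕₚ.≤-refl ν) 0# {0S} p

      ι-∑V : ∀ {k} (f : Fin k → Sm m) (f∈ : ∀ i → f i ∈V[ ν , full n ]) p →
        ι (∑V f) p ≈S ∑V (λ i → ι (f i) (f∈ i))
      ι-∑V {zero} f f∈ p = ι-𝟎 p
      ι-∑V {suc k} f f∈ p = begin
        ι (∑V f) p                                         ≈⟨ additive (f zero) (∑V (λ i → f (suc i))) (f∈ zero) rest∈ p ⟩
        ι (f zero) (f∈ zero) +S ι (∑V (λ i → f (suc i))) rest∈
                       ≈⟨ (λ a b → +-congˡ (ι-∑V (λ i → f (suc i)) (λ i → f∈ (suc i)) rest∈ a b)) ⟩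
        ∑V (λ i → ι (f i) (f∈ i))                          ∎
        where rest∈ = InSpan-∑V (first n ℕₚ.≤-refl ν) (λ i → f (suc i)) (λ i → f∈ (suc i))

      ι-lc : ∀ {k} (w : Fin k → Sm m) (w∈ : ∀ i → w i ∈V[ ν , full n ]) c p →
        ι (lc w c) p ≈S lc (λ i → ι (w i) (w∈ i)) c
      ι-lc w w∈ c p = begin
        ι (lc w c) p                         ≈⟨ ι-∑V (λ i → c i ·S w i) cw∈ p ⟩
        ∑V (λ i → ι (c i ·S w i) (cw∈ i))    ≈⟨ ∑V-cong (λ i → homogeneous (c i) (w i) (w∈ i) (cw∈ i)) ⟩
        lc (λ i → ι (w i) (w∈ i)) c          ∎
        where cw∈ = λ i → InSpan-∙ (first n ℕₚ.≤-refl ν) (c i) {w i} (w∈ i)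

      ι-vecMat : ∀ A j → ι (vecMat ν A j) (lc∈Vₙ ν (λ i → A i j) ν∈Vₙ) ≈S vecMat (λ i → ι (ν i) (ν∈Vₙ i)) A j
      ι-vecMat A j = ι-lc ν ν∈Vₙ (λ i → A i j) _

      B-data : Σ (Mat n) λ A → UpperTriangular A × (∀ j → ι (ν j) (ν∈Vₙ j) ≈S vecMat μ A j)
      B-data = triangular-coordinates μ (λ j → ι (ν j) (ν∈Vₙ j))
                 (λ j → maps-into (suc (toℕ j) , Finₚ.toℕ<n j) (ν j) (ν∈Vₙ j) (ν∈V[j+1] ν j))

      B : Mat n
      B = proj₁ B-data

      ιν≋ : ∀ j → ι (ν j) (ν∈Vₙ j) ≈S vecMat μ B j
      ιν≋ = proj₂ (proj₂ B-data)

      preimage : ∀ j → Σ (Sm m) λ x → Σ (x ∈V[ ν , full n ]) λ x∈ →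
        x ∈V[ ν , (suc (toℕ j) , Finₚ.toℕ<n j) ] × (ι x x∈ ≈S μ j)
      preimage j = maps-onto (suc (toℕ j) , Finₚ.toℕ<n j) (μ j) (ν∈V[j+1] μ j)

      x : Fin n → Sm m
      x j = proj₁ (preimage j)

      x∈Vₙ : ∀ j → x j ∈V[ ν , full n ]
      x∈Vₙ j = proj₁ (proj₂ (preimage j))

      ιx≋μ : ∀ j → ι (x j) (x∈Vₙ j) ≈S μ j
      ιx≋μ j = proj₂ (proj₂ (proj₂ (preimage j)))

      C-data : Σ (Mat n) λ A → UpperTriangular A × (∀ j → x j ≈S vecMat ν A j)
      C-data = triangular-coordinates ν x (λ j → proj₁ (proj₂ (proj₂ (preimage j))))

      C : Mat n
      C = proj₁ C-data

      C-upper : UpperTriangular C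
      C-upper = proj₁ (proj₂ C-data)

      x≋ : ∀ j → x j ≈S vecMat ν C j
      x≋ = proj₂ (proj₂ C-data)

      B⊛C≈Id : (B ⊛ C) ≈M Id
      B⊛C≈Id i j = lc-injective μ (proj₁ μ-flag) (λ i → (B ⊛ C) i j) (δ j) columns≋ i
        where
        columns≋ : vecMat μ (B ⊛ C) j ≈S lc μ (δ j)
        columns≋ = begin
          vecMat μ (B ⊛ C) j                               ≈⟨ vecMat-⊛ μ B C j ⟩
          lc (vecMat μ B) (λ k → C k j)                    ≈⟨ lc-cong ιν≋ (λ _ → refl) ⟨
          vecMat (λ k → ι (ν k) (ν∈Vₙ k)) C j              ≈⟨ ι-vecMat C j ⟨
          ι (vecMat ν C j) (lc∈Vₙ ν (λ k → C k j) ν∈Vₙ)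
                                                           ≈⟨ resp _ (x j) _ (x∈Vₙ j) (≋-sym {x j} {vecMat ν C j} (x≋ j)) ⟩
          ι (x j) (x∈Vₙ j)                                 ≈⟨ ιx≋μ j ⟩
          μ j                                              ≈⟨ lc-δ μ j ⟨
          lc μ (δ j)                                       ∎

      C⊛B≈Id : (C ⊛ B) ≈M Id
      C⊛B≈Id i j = lc-injective ν (proj₁ ν-flag) (λ i → (C ⊛ B) i j) (δ j) columns≋ i
        where
        x∈ = lc∈Vₙ x (λ k → B k j) x∈Vₙ
        ι-agrees : ι (vecMat x B j) x∈ ≈S ι (ν j) (ν∈Vₙ j)
        ι-agrees = begin
          ι (vecMat x B j) x∈                              ≈⟨ ι-lc x x∈Vₙ (λ k → B k j) x∈ ⟩
          vecMat (λ k → ι (x k) (x∈Vₙ k)) B j              ≈⟨ lc-cong ιx≋μ (λ _ → refl) ⟩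
          vecMat μ B j                                     ≈⟨ ιν≋ j ⟨
          ι (ν j) (ν∈Vₙ j)                                 ∎
        columns≋ : vecMat ν (C ⊛ B) j ≈S lc ν (δ j)
        columns≋ = begin
          vecMat ν (C ⊛ B) j                               ≈⟨ vecMat-⊛ ν C B j ⟩
          lc (vecMat ν C) (λ k → B k j)                    ≈⟨ lc-cong x≋ (λ _ → refl) ⟨
          vecMat x B j                                     ≈⟨ injective _ (ν j) x∈ (ν∈Vₙ j) ι-agrees ⟩
          ν j                                              ≈⟨ lc-δ ν j ⟨
          lc ν (δ j)                                       ∎

      module _ {N M : Mat n} (TνN : MatrixOfT ν N) (TμM : MatrixOfT μ M) where

        B⊛N≈M⊛B : (B ⊛ N) ≈M (M ⊛ B)
        B⊛N≈M⊛B i j = lc-injective μ (proj₁ μ-flag) (λ i → (B ⊛ N) i j) (λ i → (M ⊛ B) i j) columns≋ i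
          where
          Tν∈ = InSpan-resp (first n ℕₚ.≤-refl ν) {vecMat ν N j} {TS (ν j)} (≋-sym {TS (ν j)} {vecMat ν N j} (TνN j))
                  (lc∈Vₙ ν (λ k → N k j) ν∈Vₙ)
          columns≋ : vecMat μ (B ⊛ N) j ≈S vecMat μ (M ⊛ B) j
          columns≋ = begin
            vecMat μ (B ⊛ N) j                             ≈⟨ vecMat-⊛ μ B N j ⟩
            lc (vecMat μ B) (λ k → N k j)                  ≈⟨ lc-cong ιν≋ (λ _ → refl) ⟨
            vecMat (λ k → ι (ν k) (ν∈Vₙ k)) N j            ≈⟨ ι-vecMat N j ⟨
            ι (vecMat ν N j) _
                        ≈⟨ resp _ (TS (ν j)) _ Tν∈ (≋-sym {TS (ν j)} {vecMat ν N j} (TνN j)) ⟩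
            ι (TS (ν j)) Tν∈                               ≈⟨ commutes (ν j) (ν∈Vₙ j) Tν∈ ⟩
            TS (ι (ν j) (ν∈Vₙ j))                          ≈⟨ TS-cong {ι (ν j) (ν∈Vₙ j)} {vecMat μ B j} (ιν≋ j) ⟩
            TS (vecMat μ B j)                              ≈⟨ TS-lc μ M TμM (λ k → B k j) ⟩
            vecMat μ (M ⊛ B) j                             ∎

        conj : Conj N M
        conj = C , B , C-upper , C⊛B≈Id , B⊛C≈Id , M≈B⊛N⊛C
          where
          M≈B⊛N⊛C : M ≈M ((B ⊛ N) ⊛ C)
          M≈B⊛N⊛C = ≈M-trans (≈M-sym (⊛-identityʳ M))
                   (≈M-trans (⊛-cong ≈M-refl (≈M-sym B⊛C≈Id))
                   (≈M-trans (≈M-sym (⊛-assoc M B C))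
                             (⊛-cong (≈M-sym B⊛N≈M⊛B) ≈M-refl)))

    flagIso⇒conj : ∀ {n} (ν μ : Fin n → Sm m) (N M : Mat n) → IsTorsionFlagBasis ν → IsTorsionFlagBasis μ →
      MatrixOfT ν N → MatrixOfT μ M → FlagIso ν μ → Conj N M
    flagIso⇒conj ν μ N M ν-flag μ-flag TνN TμM iso = Isomorphism.conj ν-flag μ-flag iso TνN TμM

    module Conjugation {n} {ν μ : Fin n → Sm m} {N M : Mat n}
                       (ν-flag : IsTorsionFlagBasis ν) (μ-flag : IsTorsionFlagBasis μ)
                       (TνN : MatrixOfT ν N) (TμM : MatrixOfT μ M)
                       {P P⁻¹ : Mat n} (P-upper : UpperTriangular P)
                       (P⊛P⁻¹≈Id : (P ⊛ P⁻¹) ≈M Id) (P⁻¹⊛P≈Id : (P⁻¹ ⊛ P) ≈M Id)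
                       (M≈P⁻¹NP : M ≈M ((P⁻¹ ⊛ N) ⊛ P)) where

      P⁻¹-upper : UpperTriangular P⁻¹
      P⁻¹-upper = UpperTriangular-leftInverse P-upper P⁻¹⊛P≈Id

      M⊛P⁻¹≈P⁻¹⊛N : (M ⊛ P⁻¹) ≈M (P⁻¹ ⊛ N)
      M⊛P⁻¹≈P⁻¹⊛N = ≈M-trans (⊛-cong M≈P⁻¹NP ≈M-refl)
                    (≈M-trans (⊛-assoc (P⁻¹ ⊛ N) P P⁻¹)
                    (≈M-trans (⊛-cong ≈M-refl P⊛P⁻¹≈Id) (⊛-identityʳ (P⁻¹ ⊛ N))))

      coords : ∀ x → x ∈V[ ν , full n ] → Fin n → Carrier
      coords x x∈ = proj₁ (∈V-full⇒ ν {x} x∈)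

      coords-spec : ∀ x x∈ → x ≈S lc ν (coords x x∈)
      coords-spec x x∈ = proj₂ (∈V-full⇒ ν {x} x∈)

      coords-unique : ∀ x x∈ c → x ≈S lc ν c → ∀ i → coords x x∈ i ≈ c i
      coords-unique x x∈ c x≋ = lc-injective ν (proj₁ ν-flag) (coords x x∈) c (begin
        lc ν (coords x x∈)   ≈⟨ coords-spec x x∈ ⟨
        x                    ≈⟨ x≋ ⟩
        lc ν c               ∎)

      ι : ∀ x → x ∈V[ ν , full n ] → Sm m
      ι x x∈ = lc μ (matVec P⁻¹ (coords x x∈))

      ι-lc : ∀ x x∈ c → x ≈S lc ν c → ι x x∈ ≈S lc μ (matVec P⁻¹ c)
      ι-lc x x∈ c x≋ = lc-congʳ μ (matVec-congʳ P⁻¹ (coords-unique x x∈ c x≋))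

      resp : ∀ x y x∈ y∈ → x ≈S y → ι x x∈ ≈S ι y y∈
      resp x y x∈ y∈ x≋y = ι-lc x x∈ (coords y y∈) (λ a b → trans (x≋y a b) (coords-spec y y∈ a b))

      additive : ∀ x y x∈ y∈ x+y∈ → ι (x +S y) x+y∈ ≈S (ι x x∈ +S ι y y∈)
      additive x y x∈ y∈ x+y∈ = begin
        ι (x +S y) x+y∈                                ≈⟨ ι-lc (x +S y) x+y∈ (λ i → c i + d i) x+y≋ ⟩
        lc μ (matVec P⁻¹ (λ i → c i + d i))            ≈⟨ lc-congʳ μ (matVec-+ P⁻¹ c d) ⟩
        lc μ (λ k → matVec P⁻¹ c k + matVec P⁻¹ d k)   ≈⟨ lc-+ μ (matVec P⁻¹ c) (matVec P⁻¹ d) ⟩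
        ι x x∈ +S ι y y∈                               ∎
        where
        c = coords x x∈
        d = coords y y∈
        x+y≋ : (x +S y) ≈S lc ν (λ i → c i + d i)
        x+y≋ = begin
          x +S y              ≈⟨ (λ a b → +-cong (coords-spec x x∈ a b) (coords-spec y y∈ a b)) ⟩
          lc ν c +S lc ν d    ≈⟨ lc-+ ν c d ⟨
          lc ν (λ i → c i + d i) ∎

      homogeneous : ∀ a x x∈ ax∈ → ι (a ·S x) ax∈ ≈S (a ·S ι x x∈)
      homogeneous a x x∈ ax∈ = begin
        ι (a ·S x) ax∈                       ≈⟨ ι-lc (a ·S x) ax∈ (λ i → a * c i) ax≋ ⟩
        lc μ (matVec P⁻¹ (λ i → a * c i))    ≈⟨ lc-congʳ μ (matVec-* P⁻¹ a c) ⟩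
        lc μ (λ k → a * matVec P⁻¹ c k)      ≈⟨ lc-* μ a (matVec P⁻¹ c) ⟩
        a ·S ι x x∈                          ∎
        where
        c = coords x x∈
        ax≋ : (a ·S x) ≈S lc ν (λ i → a * c i)
        ax≋ = begin
          a ·S x              ≈⟨ (λ k l → *-congˡ (coords-spec x x∈ k l)) ⟩
          a ·S lc ν c         ≈⟨ lc-* ν a c ⟨
          lc ν (λ i → a * c i) ∎

      injective : ∀ x y x∈ y∈ → ι x x∈ ≈S ι y y∈ → x ≈S y
      injective x y x∈ y∈ ιx≋ιy = begin
        x                    ≈⟨ coords-spec x x∈ ⟩
        lc ν (coords x x∈)   ≈⟨ lc-congʳ ν (matVec-injective P⊛P⁻¹≈Id _ _
                                  (lc-injective μ (proj₁ μ-flag) _ _ ιx≋ιy)) ⟩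
        lc ν (coords y y∈)   ≈⟨ coords-spec y y∈ ⟨
        y                    ∎

      maps-into : ∀ (i : Σ ℕ (λ i → i ≤ n)) x x∈ → x ∈V[ ν , i ] → ι x x∈ ∈V[ μ , i ]
      maps-into (i , i≤n) x x∈ x∈Vᵢ =
        let d , x≋ , d↓ = InSpan-first⇒ i≤n ν {x} x∈Vᵢ
        in InSpan-first⇐ i≤n μ {ι x x∈} (matVec P⁻¹ (coords x x∈)) (≋-refl {ι x x∈})
             (λ k i≤k → trans (matVec-congʳ P⁻¹ (coords-unique x x∈ d x≋) k)
                              (matVec-supportedBelow P⁻¹-upper i d↓ k i≤k))

      maps-onto : ∀ (i : Σ ℕ (λ i → i ≤ n)) w → w ∈V[ μ , i ] →
        Σ (Sm m) λ x → Σ (x ∈V[ ν , full n ]) λ x∈ → x ∈V[ ν , i ] × (ι x x∈ ≈S w)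
      maps-onto (i , i≤n) w w∈Wᵢ = x , x∈ , x∈Vᵢ , ιx≋w
        where
        d↓ = InSpan-first⇒ i≤n μ {w} w∈Wᵢ
        d = proj₁ d↓
        x = lc ν (matVec P d)
        x∈ = ∈V-full⇐ ν {x} (InSpan-lc ν (matVec P d))
        x∈Vᵢ = InSpan-first⇐ i≤n ν {x} (matVec P d) (≋-refl {x})
                 (matVec-supportedBelow P-upper i (proj₂ (proj₂ d↓)))
        ιx≋w : ι x x∈ ≈S w
        ιx≋w = begin
          ι x x∈                            ≈⟨ ι-lc x x∈ (matVec P d) (≋-refl {x}) ⟩
          lc μ (matVec P⁻¹ (matVec P d))    ≈⟨ lc-congʳ μ (λ k → matVec-⊛ P⁻¹ P d k) ⟨
          lc μ (matVec (P⁻¹ ⊛ P) d)         ≈⟨ lc-congʳ μ (λ k → trans (matVec-cong P⁻¹⊛P≈Id (λ _ → refl) k)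
                                                                       (matVec-Id d k)) ⟩
          lc μ d                            ≈⟨ proj₁ (proj₂ d↓) ⟨
          w                                 ∎

      commutes : ∀ x x∈ Tx∈ → ι (TS x) Tx∈ ≈S TS (ι x x∈)
      commutes x x∈ Tx∈ = begin
        ι (TS x) Tx∈                            ≈⟨ ι-lc (TS x) Tx∈ (matVec N c) Tx≋ ⟩
        lc μ (matVec P⁻¹ (matVec N c))          ≈⟨ lc-congʳ μ (λ k → matVec-⊛ P⁻¹ N c k) ⟨
        lc μ (matVec (P⁻¹ ⊛ N) c)               ≈⟨ lc-congʳ μ (matVec-cong (≈M-sym M⊛P⁻¹≈P⁻¹⊛N) (λ _ → refl)) ⟩
        lc μ (matVec (M ⊛ P⁻¹) c)               ≈⟨ lc-congʳ μ (matVec-⊛ M P⁻¹ c) ⟩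
        lc μ (matVec M (matVec P⁻¹ c))          ≈⟨ TS-lc μ M TμM (matVec P⁻¹ c) ⟨
        TS (ι x x∈)                             ∎
        where
        c = coords x x∈
        Tx≋ : TS x ≈S lc ν (matVec N c)
        Tx≋ = begin
          TS x          ≈⟨ TS-cong {x} {lc ν c} (coords-spec x x∈) ⟩
          TS (lc ν c)   ≈⟨ TS-lc ν N TνN c ⟩
          lc ν (matVec N c) ∎

    conj⇒flagIso : ∀ {n} (ν μ : Fin n → Sm m) (N M : Mat n) → IsTorsionFlagBasis ν → IsTorsionFlagBasis μ →
      MatrixOfT ν N → MatrixOfT μ M → Conj N M → FlagIso ν μ
    conj⇒flagIso ν μ N M ν-flag μ-flag TνN TμM (_ , _ , P-upper , P⊛P⁻¹≈Id , P⁻¹⊛P≈Id , M≈P⁻¹NP) = record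
      { ι = ι ; resp = resp ; additive = additive ; homogeneous = homogeneous ; injective = injective
      ; maps-into = maps-into ; maps-onto = maps-onto ; commutes = commutes }
      where open Conjugation ν-flag μ-flag TνN TμM P-upper P⊛P⁻¹≈Id P⁻¹⊛P≈Id M≈P⁻¹NP

    lc-columnCombination : ∀ {n k} (ν : Fin n → Sm m) (u : Fin k → Fin n → Carrier) a →
      lc ν (ColumnAlgebra.lc n u a) ≈S lc (λ t → lc ν (u t)) a
    lc-columnCombination ν u a = begin
      lc ν (ColumnAlgebra.lc _ u a)           ≈⟨ lc-congʳ ν (λ i → trans (lc-column u a i)
                                                    (∑-cong (λ t → *-comm (a t) (u t i)))) ⟩
      lc ν (λ i → ∑ (λ t → u t i * a t))      ≈⟨ lc-lc ν (λ i t → u t i) a ⟨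
      lc (λ t → lc ν (u t)) a                 ∎

    -- ν maps a basis of the column space of N onto a basis of T V_n
    dimTV≡rank : ∀ {n} (ν : Fin n → Sm m) (N : Mat n) (r : ℕ) → IsTorsionFlagBasis ν → MatrixOfT ν N →
      Rank N r → DimTV ν r
    dimTV≡rank {n} ν N r ν-flag TνN (b , b-indep , b∈ , columns∈) = B , B-indep , B∈TV , TV⊆span
      where
      module Cols = ColumnAlgebra n
      B : Fin r → Sm m
      B t = lc ν (b t)
      B-indep : LinIndep B
      B-indep c lcB≋𝟎 = b-indep c (λ i → lc-injective ν (proj₁ ν-flag) (Cols.lc b c) (λ _ → 0#) lcν≋ i)
        where
        lcν≋ : lc ν (Cols.lc b c) ≈S lc ν (λ _ → 0#)
        lcν≋ = begin
          lc ν (Cols.lc b c)     ≈⟨ lc-columnCombination ν b c ⟩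
          lc B c                 ≈⟨ lcB≋𝟎 ⟩
          0S                     ≈⟨ lc-zero ν (λ _ → 0#) (λ _ → refl) ⟨
          lc ν (λ _ → 0#)        ∎
      B∈TV : ∀ t → Σ (Sm m) λ x → x ∈V[ ν , full n ] × (B t ≈S TS x)
      B∈TV t = let d , bₜ≋ = b∈ t in lc ν d , ∈V-full⇐ ν {lc ν d} (InSpan-lc ν d) , (begin
        lc ν (b t)             ≈⟨ lc-congʳ ν (λ i → trans (bₜ≋ i) (sym (matVec-columns N d i))) ⟩
        lc ν (matVec N d)      ≈⟨ TS-lc ν N TνN d ⟨
        TS (lc ν d)            ∎)
      TV⊆span : ∀ y → (Σ (Sm m) λ x → x ∈V[ ν , full n ] × (y ≈S TS x)) → InSpan B y
      TV⊆span y (x , x∈ , y≋) = a , (begin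
        y                                        ≈⟨ y≋ ⟩
        TS x                                     ≈⟨ TS-cong {x} {lc ν c} x≋ ⟩
        TS (lc ν c)                              ≈⟨ TS-lc ν N TνN c ⟩
        lc ν (matVec N c)                        ≈⟨ lc-congʳ ν (matVec-columns N c) ⟩
        lc ν (Cols.lc (columns N) c)             ≈⟨ lc-congʳ ν (Cols.lc-cong (λ j → proj₂ (columns∈ j)) (λ _ → refl)) ⟩
        lc ν (Cols.lc (λ j → Cols.lc b (proj₁ (columns∈ j))) c)
                                                 ≈⟨ lc-congʳ ν (Cols.lc-lc b (λ t j → proj₁ (columns∈ j) t) c) ⟩
        lc ν (Cols.lc b a)                       ≈⟨ lc-columnCombination ν b a ⟩
        lc B a                                   ∎)
        where
        c = proj₁ (∈V-full⇒ ν {x} x∈)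
        x≋ = proj₂ (∈V-full⇒ ν {x} x∈)
        a : Fin r → Carrier
        a t = ∑ (λ j → proj₁ (columns∈ j) t * c j)

    tOrder≡n∸rank : ∀ {n} (ν : Fin n → Sm m) (N : Mat n) (r : ℕ) → IsTorsionFlagBasis ν → MatrixOfT ν N →
      Rank N r → HasTOrder ν (n ∸ r)
    tOrder≡n∸rank ν N r ν-flag TνN rankN = r , dimTV≡rank ν N r ν-flag TνN rankN , ≡.refl

    InSocle : Sm m → Set
    InSocle x = TS x ≈S 0S

    InSocle-lc : ∀ {k} (w : Fin k → Sm m) c → (∀ t → InSocle (w t)) → InSocle (lc w c)
    InSocle-lc w c w-socle = begin
      TS (lc w c)                 ≈⟨ TS-∑V (λ t → c t ·S w t) ⟩
      lc (λ t → TS (w t)) c       ≈⟨ lc-cong w-socle (λ _ → refl) ⟩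
      lc (λ _ → 0S) c             ≈⟨ ∑V-𝟎 _ (λ t → ∙-zeroʳ (c t)) ⟩
      0S                          ∎

    InSocle⇒≈0 : ∀ x → InSocle x → (∀ l → coeff x 0 l ≈ 0#) → x ≈S 0S
    InSocle⇒≈0 x Tx≈0 x₀≈0 zero l = x₀≈0 l
    InSocle⇒≈0 x Tx≈0 x₀≈0 (suc k) l = Tx≈0 k l

    module SocleVectors {n} (ν : Fin n → Sm m) (N : Mat n) (TνN : MatrixOfT ν N) where
      open ColumnEchelon N

      socleVector : Σ (Fin n) Dependent → Sm m
      socleVector d = lc ν (kernelVector d)

      socleVector∈socle : ∀ d → InSocle (socleVector d)
      socleVector∈socle d = begin
        TS (lc ν (kernelVector d))          ≈⟨ TS-lc ν N TνN (kernelVector d) ⟩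
        lc ν (matVec N (kernelVector d))    ≈⟨ lc-zero ν _ (matVec-kernelVector d) ⟩
        0S                                  ∎

      κ : Σ (Fin n) Dependent → Fin m → Carrier
      κ d = coeff (socleVector d) 0

    -- the socle vectors of the dependent columns have independent leading coefficients κ in F^m
    module RankBound {n} (ν : Fin n → Sm m) (N : Mat n) (ν-flag : IsTorsionFlagBasis ν) (TνN : MatrixOfT ν N) where
      open ColumnEchelon N
      open SocleVectors ν N TνN
      module Fᵐ = ColumnAlgebra m

      κ-free : ∀ j → Fᵐ.Free (λ t → κ (dependent-column j t))
      κ-free zero = tt
      κ-free (suc j) with kind j
      ... | beyond _ = κ-free j
      ... | pivot _ _ = κ-free j
      ... | dependent j<n dep = κ∉span , κ-free j
        where
        J = fromℕ< j<n
        d = J , dep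
        K = dependent-column j
        K<J : ∀ t → toℕ (proj₁ (K t)) < toℕ J
        K<J t = ≡.subst (toℕ (proj₁ (K t)) <_) (≡.sym (Finₚ.toℕ-fromℕ< j<n)) (dependent-column< j t)
        κ∉span : ¬ Fᵐ.InSpan (λ t → κ (K t)) (κ d)
        κ∉span (c , κd≋) = 0≉1 (trans (sym (a≈0 J)) a-pivot)
          where
          a : Fin n → Carrier
          a i = kernelVector d i + (- 1#) * ∑ (λ t → kernelVector (K t) i * c t)
          y = socleVector d +S ((- 1#) ·S lc (λ t → socleVector (K t)) c)
          y≈0 : y ≈S 0S
          y≈0 = InSocle⇒≈0 y y∈socle y₀≈0
            where
            y∈socle : InSocle y
            y∈socle k l = trans (+-cong (socleVector∈socle d k l)
                                        (*-congˡ (InSocle-lc _ c (λ t → socleVector∈socle (K t)) k l)))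
                                (trans (+-identityˡ _) (zeroʳ _))
            y₀≈0 : ∀ l → coeff y 0 l ≈ 0#
            y₀≈0 l = trans (+-cong (trans (κd≋ l) (lc-column (λ t → κ (K t)) c l))
                                   (*-congˡ (≡⇒≈ (∑V-coeff (λ t → c t ·S socleVector (K t)) 0 l))))
                           (x+-1*x≈0 _)
          a≈0 : ∀ i → a i ≈ 0#
          a≈0 = lc-injective ν (proj₁ ν-flag) a (λ _ → 0#) (begin
            lc ν a            ≈⟨ lc-sub ν (kernelVector d) _ ⟩
            socleVector d +S ((- 1#) ·S lc ν (λ i → ∑ (λ t → kernelVector (K t) i * c t)))
                              ≈⟨ (λ k l → +-congˡ (*-congˡ (lc-lc ν (λ i t → kernelVector (K t) i) c k l))) ⟨
            y                 ≈⟨ y≈0 ⟩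
            0S                ≈⟨ lc-zero ν (λ _ → 0#) (λ _ → refl) ⟨
            lc ν (λ _ → 0#)   ∎)
          a-pivot : a J ≈ 1#
          a-pivot = trans (+-cong (kernelVector-pivot d)
                                  (*-congˡ (∑-zero _ (λ t → trans (*-congʳ (kernelVector-above (K t) J (K<J t))) (zeroˡ _)))))
                          (trans (+-congˡ (zeroʳ _)) (+-identityʳ 1#))

      #dependents≤m : #dependents n ≤ m
      #dependents≤m = steinitz-columns m _ (λ t → κ (dependent-column n t))
                        (Fᵐ.Free⇒LinIndep _ (κ-free n))

      n∸m≤rank : n ∸ m ≤ #pivots n
      n∸m≤rank = ∸-≤-of-sum (#pivots+#dependents n ℕₚ.≤-refl) #dependents≤m

    matrixOfT-∈Uo : ∀ {n} (ν : Fin n → Sm m) (N : Mat n) → IsTorsionFlagBasis ν → MatrixOfT ν N → Uo[ n , m ] N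
    matrixOfT-∈Uo {n} ν N ν-flag TνN =
      (StrictlyUpper⇒UpperTriangular N↗ , StrictlyUpper⇒Nilpotent N N↗) , #pivots n , rank-#pivots , n∸m≤rank
      where
      N↗ = matrixOfT-strictlyUpper ν N ν-flag TνN
      open ColumnEchelon N
      open RankBound ν N ν-flag TνN

    strictlyUpper⇒torsion : ∀ {n} (ν : Fin n → Sm m) (N : Mat n) → MatrixOfT ν N → StrictlyUpper N →
      ∀ i (i<n : i < n) x → x ∈V[ ν , (suc i , i<n) ] → TS x ∈V[ ν , (i , ℕₚ.<⇒≤ i<n) ]
    strictlyUpper⇒torsion ν N TνN N↗ i i<n x x∈ =
      let c , x≋ , c↓ = InSpan-first⇒ i<n ν {x} x∈
      in InSpan-first⇐ (ℕₚ.<⇒≤ i<n) ν {TS x} (matVec N c) (begin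
           TS x            ≈⟨ TS-cong {x} {lc ν c} x≋ ⟩
           TS (lc ν c)     ≈⟨ TS-lc ν N TνN c ⟩
           lc ν (matVec N c) ∎) (matVec-strictlyUpper N↗ i c↓)

    shift : Sm m → Sm m
    shift x = record
      { coeff = λ { zero l → 0# ; (suc k) l → coeff x k l }
      ; bound = suc (bound x)
      ; support = λ { zero () l ; (suc k) (s≤s b≤k) l → support x k b≤k l } }

    socle : (Fin m → Carrier) → Sm m
    socle σ = record
      { coeff = λ { zero l → σ l ; (suc k) l → 0# }
      ; bound = 1
      ; support = λ { zero () l ; (suc k) _ l → refl } }

    indicator : ∀ {P : Set} → Dec P → Carrier
    indicator (yes _) = 1#
    indicator (no _) = 0#

    unitAt : ℕ → Fin m → Carrier
    unitAt d l = indicator (toℕ l ℕ.≟ d)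

    unitAt-on : ∀ {d} l → toℕ l ≡ d → unitAt d l ≈ 1#
    unitAt-on {d} l l≡d with toℕ l ℕ.≟ d
    ... | yes _ = refl
    ... | no l≢d = ⊥-elim (l≢d l≡d)

    unitAt-off : ∀ {d} l → toℕ l ≢ d → unitAt d l ≈ 0#
    unitAt-off {d} l l≢d with toℕ l ℕ.≟ d
    ... | yes l≡d = ⊥-elim (l≢d l≡d)
    ... | no _ = refl

    -- Column j of N is realised by a preimage under T of Σᵢ N i j νᵢ; a dependent column j additionally
    -- gets the d-th socle vector (d = number of earlier dependent columns), corrected so that
    -- ν_j − Σᵢ bᵢ νᵢ is exactly that socle vector.  The invariant carried along: ν_0, …, ν_{j-1} are
    -- independent, and the kernel of T on their span only has leading coefficients in the first d coordinates.
    module Realisation {n} (N : Mat n) (N∈Uo : Uo[ n , m ] N) where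
      open ColumnEchelon N

      N↗ : StrictlyUpper N
      N↗ = Nilpotent∧UpperTriangular⇒StrictlyUpper (proj₁ (proj₁ N∈Uo)) (proj₂ (proj₁ N∈Uo))

      #dependents≤m : #dependents n ≤ m
      #dependents≤m = let r , rankN , n∸m≤r = proj₂ N∈Uo in
        summand-≤ (#pivots+#dependents n ℕₚ.≤-refl) n∸m≤r (rank≤#pivots r rankN)

      next : ∀ j → ColumnKind j → (Fin n → Sm m) → Sm m
      next j (beyond _) ν = 0S
      next j (pivot j<n _) ν = shift (lc ν (columns N (fromℕ< j<n)))
      next j (dependent j<n (b , _)) ν =
        shift (lc ν (columns N (fromℕ< j<n))) +S socle (λ l → unitAt (#dependents j) l + coeff (lc ν b) 0 l)

      replace : ∀ j → Sm m → (Fin n → Sm m) → (i : Fin n) → Dec (toℕ i ≡ j) → Sm m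
      replace j x ν i (yes _) = x
      replace j x ν i (no _) = ν i

      stage : ℕ → Fin n → Sm m
      stage zero _ = 0S
      stage (suc j) i = replace j (next j (kind j) (stage j)) (stage j) i (toℕ i ℕ.≟ j)

      ν : Fin n → Sm m
      ν = stage n

      stage-final : ∀ j i → toℕ i < j → stage j i ≡ next (toℕ i) (kind (toℕ i)) (stage (toℕ i))
      stage-final (suc j) i i<j+1 with toℕ i ℕ.≟ j
      ... | yes ≡.refl = ≡.refl
      ... | no i≢j = stage-final j i (ℕₚ.≤∧≢⇒< (ℕ.s≤s⁻¹ i<j+1) i≢j)

      ν-final : ∀ j (j<n : j < n) → ν (fromℕ< j<n) ≡ next j (kind j) (stage j)
      ν-final j j<n = ≡.subst (λ k → ν (fromℕ< j<n) ≡ next k (kind k) (stage k)) (Finₚ.toℕ-fromℕ< j<n)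
                        (stage-final n (fromℕ< j<n) (Finₚ.toℕ<n _))

      lc-stage : ∀ j c → SupportedBelow j c → lc (stage j) c ≈S lc ν c
      lc-stage j c = lc-agree j (stage j) ν c λ i i<j →
        ≡.trans (stage-final j i i<j) (≡.sym (stage-final n i (Finₚ.toℕ<n i)))

      T-next : ∀ J → TS (next (toℕ J) (kind (toℕ J)) (stage (toℕ J))) ≈S lc ν (columns N J)
      T-next J with kind (toℕ J)
      ... | beyond J≮n = ⊥-elim (J≮n (Finₚ.toℕ<n J))
      ... | pivot J<n _ rewrite Finₚ.fromℕ<-toℕ J J<n = lc-stage (toℕ J) (columns N J) (λ i → N↗ i J)
      ... | dependent J<n _ rewrite Finₚ.fromℕ<-toℕ J J<n =
            λ k l → trans (+-identityʳ _) (lc-stage (toℕ J) (columns N J) (λ i → N↗ i J) k l)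

      Tν≈ : MatrixOfT ν N
      Tν≈ J rewrite stage-final n J (Finₚ.toℕ<n J) = T-next J

      T-lcν : ∀ c → TS (lc ν c) ≈S lc ν (matVec N c)
      T-lcν = TS-lc ν N Tν≈

      IndependentBelow : ℕ → Set
      IndependentBelow j = ∀ c → SupportedBelow j c → lc ν c ≈S 0S → ∀ i → c i ≈ 0#

      SocleBelow : ℕ → ℕ → Set
      SocleBelow j d = ∀ c → SupportedBelow j c → InSocle (lc ν c) → ∀ l → d ≤ toℕ l → coeff (lc ν c) 0 l ≈ 0#

      pivot-step : ∀ {j d} (j<n : j < n) → ¬ Dependent (fromℕ< j<n) →
        IndependentBelow j × SocleBelow j d → IndependentBelow (suc j) × SocleBelow (suc j) d
      pivot-step {j} j<n ¬dep (independent , socle-bounded) =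
        (λ c c↓ lc≈0 → independent c (c↓′ c c↓ λ k l → lc≈0 (suc k) l) lc≈0) ,
        (λ c c↓ Tlc≈0 → socle-bounded c (c↓′ c c↓ Tlc≈0) Tlc≈0)
        where
        J = fromℕ< j<n
        J≡j = Finₚ.toℕ-fromℕ< j<n
        cJ≈0 : ∀ c → SupportedBelow (suc j) c → InSocle (lc ν c) → c J ≈ 0#
        cJ≈0 c c↓ Tlc≈0 = decidable-stable (c J ≟ 0#) λ cJ≉0 → ¬dep (b cJ≉0 , b↓ cJ≉0 , NJ≈Nb cJ≉0)
          where
          Nc≈0 : ∀ i → matVec N c i ≈ 0#
          Nc≈0 = independent (matVec N c) (matVec-strictlyUpper N↗ j c↓) (λ k l → trans (sym (T-lcν c k l)) (Tlc≈0 k l))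
          b : ¬ c J ≈ 0# → Fin n → Carrier
          b cJ≉0 k = ((- 1#) * inv (c J) cJ≉0) * erase J c k
          b↓ : ∀ cJ≉0 → SupportedBelow (toℕ J) (b cJ≉0)
          b↓ cJ≉0 k J≤k = trans (*-congˡ (erase-supportedBelow J≡j c↓ k (≡.subst (_≤ toℕ k) J≡j J≤k))) (zeroʳ _)
          NJ≈Nb : ∀ cJ≉0 i → N i J ≈ matVec N (b cJ≉0) i
          NJ≈Nb cJ≉0 i = trans (x+ay≈0⇒y≈-a⁻¹x _ (c J) (N i J) cJ≉0 (trans (matVec-erase N J c i) (Nc≈0 i)))
                               (sym (matVec-* N _ (erase J c) i))
        c↓′ : ∀ c → SupportedBelow (suc j) c → InSocle (lc ν c) → SupportedBelow j c
        c↓′ c c↓ Tlc≈0 = SupportedBelow-suc J≡j c↓ (cJ≈0 c c↓ Tlc≈0)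

      dependent-step : ∀ {j} (j<n : j < n) (dep : Dependent (fromℕ< j<n)) → kind j ≡ dependent j<n dep →
        suc (#dependents j) ≤ m → IndependentBelow j × SocleBelow j (#dependents j) →
        IndependentBelow (suc j) × SocleBelow (suc j) (suc (#dependents j))
      dependent-step {j} j<n dep@(b , b↓ , _) kind≡ d<m (independent , socle-bounded) =
        independent′ , socle-bounded′
        where
        open SocleVectors ν N Tν≈
        J = fromℕ< j<n
        J≡j = Finₚ.toℕ-fromℕ< j<n
        w = socleVector (J , dep)
        b↓′ : SupportedBelow j b
        b↓′ k j≤k = b↓ k (≡.subst (_≤ toℕ k) (≡.sym J≡j) j≤k)

        νJ₀≡ : ∀ l → coeff (ν J) 0 l ≡ 0# + (unitAt (#dependents j) l + coeff (lc (stage j) b) 0 l)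
        νJ₀≡ l = ≡.cong (λ x → coeff x 0 l) (≡.trans (ν-final j j<n) (≡.cong (λ κ → next j κ (stage j)) kind≡))

        w₀≈unit : ∀ l → coeff w 0 l ≈ unitAt (#dependents j) l
        w₀≈unit l = trans (lc-sub ν (δ J) b 0 l) (trans (+-congʳ (lc-δ ν J 0 l))
          (trans (+-congʳ (trans (≡⇒≈ (νJ₀≡ l)) (trans (+-identityˡ _) (+-congˡ (lc-stage j b b↓′ 0 l)))))
                 (x+y+-1*y≈x _ _)))

        rest : (Fin n → Carrier) → Fin n → Carrier
        rest c i = erase J c i + c J * b i

        rest↓ : ∀ c → SupportedBelow (suc j) c → SupportedBelow j (rest c)
        rest↓ c c↓ k j≤k = trans (+-cong (erase-supportedBelow J≡j c↓ k j≤k) (trans (*-congˡ (b↓′ k j≤k)) (zeroʳ _)))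
                                 (+-identityˡ 0#)

        coeffs-split : ∀ c i → c i ≈ rest c i + c J * kernelVector (J , dep) i
        coeffs-split c i = trans (erase-split J c i) (x+ay≈[x+az]+a[y-z] (erase J c i) (c J) (δ J i) (b i))

        lc-split : ∀ c → lc ν c ≈S (lc ν (rest c) +S (c J ·S w))
        lc-split c = begin
          lc ν c                                                 ≈⟨ lc-congʳ ν (coeffs-split c) ⟩
          lc ν (λ i → rest c i + c J * kernelVector (J , dep) i) ≈⟨ lc-+ ν (rest c) _ ⟩
          lc ν (rest c) +S lc ν (λ i → c J * kernelVector (J , dep) i)
                                                                 ≈⟨ (λ k l → +-congˡ (lc-* ν (c J) (kernelVector (J , dep)) k l)) ⟩
          lc ν (rest c) +S (c J ·S w)                            ∎

        rest∈socle : ∀ c → InSocle (lc ν c) → InSocle (lc ν (rest c))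
        rest∈socle c Tlc≈0 k l =
          trans (sym (x+a*0≈x _ (c J) (socleVector∈socle (J , dep) k l))) (trans (sym (lc-split c (suc k) l)) (Tlc≈0 k l))

        rest₀≈0 : ∀ c → SupportedBelow (suc j) c → InSocle (lc ν c) → ∀ l → #dependents j ≤ toℕ l →
          coeff (lc ν (rest c)) 0 l ≈ 0#
        rest₀≈0 c c↓ Tlc≈0 = socle-bounded (rest c) (rest↓ c c↓) (rest∈socle c Tlc≈0)

        socle-bounded′ : SocleBelow (suc j) (suc (#dependents j))
        socle-bounded′ c c↓ Tlc≈0 l d<l = trans (lc-split c 0 l)
          (trans (+-congʳ (rest₀≈0 c c↓ Tlc≈0 l (ℕₚ.<⇒≤ d<l)))
          (trans (+-identityˡ _) (trans (*-congˡ (trans (w₀≈unit l) (unitAt-off l (λ l≡d → ℕₚ.<⇒≢ d<l (≡.sym l≡d)))))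
                 (zeroʳ _))))

        independent′ : IndependentBelow (suc j)
        independent′ c c↓ lc≈0 i = trans (coeffs-split c i) (trans (x+0*y≈x _ _ cJ≈0) (rest≈0 i))
          where
          l₀ = fromℕ< d<m
          l₀≡d = Finₚ.toℕ-fromℕ< d<m
          cJ≈0 : c J ≈ 0#
          cJ≈0 = 0+a*1≈0⇒a≈0 (rest₀≈0 c c↓ (λ k l → lc≈0 (suc k) l) l₀ (ℕₚ.≤-reflexive (≡.sym l₀≡d)))
                              (trans (w₀≈unit l₀) (unitAt-on l₀ l₀≡d)) (trans (sym (lc-split c 0 l₀)) (lc≈0 0 l₀))
          rest≈0 : ∀ i → rest c i ≈ 0#
          rest≈0 = independent (rest c) (rest↓ c c↓) λ k l →
            trans (sym (x+0*y≈x _ _ cJ≈0)) (trans (sym (lc-split c k l)) (lc≈0 k l))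

      invariant : ∀ j → j ≤ n → IndependentBelow j × SocleBelow j (#dependents j)
      invariant zero _ = (λ c c↓ _ i → c↓ i z≤n) , (λ c c↓ _ l _ → lc-zero ν c (λ i → c↓ i z≤n) 0 l)
      invariant (suc j) j<n with kind j in kind≡
      ... | beyond j≮n = ⊥-elim (j≮n j<n)
      ... | pivot j<n′ ¬dep = pivot-step j<n′ ¬dep (invariant j (ℕₚ.<⇒≤ j<n))
      ... | dependent j<n′ dep = dependent-step j<n′ dep kind≡ d<m (invariant j (ℕₚ.<⇒≤ j<n))
        where
        d<m : suc (#dependents j) ≤ m
        d<m = ≡.subst (λ κ → proj₁ (addDependent j κ (dependents j)) ≤ m) kind≡
                (ℕₚ.≤-trans (#dependents-mono j<n) #dependents≤m)

      ν-flag : IsTorsionFlagBasis ν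
      ν-flag = (λ c → proj₁ (invariant n ℕₚ.≤-refl) c (λ k n≤k → ⊥-elim (ℕₚ.<⇒≱ (Finₚ.toℕ<n k) n≤k)))
             , strictlyUpper⇒torsion ν N Tν≈ N↗

    Uo-realised : ∀ {n} (N : Mat n) → Uo[ n , m ] N →
      Σ (Fin n → Sm m) λ ν → IsTorsionFlagBasis ν × Σ (Mat n) (λ M → MatrixOfT ν M × Conj M N)
    Uo-realised N N∈Uo = ν , ν-flag , N , Tν≈ , Conj-refl N
      where open Realisation N N∈Uo

proposition3p6 :
  (F : FiniteField) (n m : ℕ) → 1 ≤ n → 2 ≤ m →
  let open Over F in
  -- every T-torsion n-flag (with ordered basis ν) has a matrix N of T,
  (∀ (ν : Fin n → Sm m) → IsTorsionFlagBasis ν → Σ (Mat n) (λ N → MatrixOfT ν N))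
  -- and it lies in U^o_{n,m}
  × (∀ (ν : Fin n → Sm m) (N : Mat n) → IsTorsionFlagBasis ν → MatrixOfT ν N →
       Uo[ n , m ] N)
  -- well-defined: isomorphic flags give U^*_n-conjugate matrices
  × (∀ (ν μ : Fin n → Sm m) (N M : Mat n) →
       IsTorsionFlagBasis ν → IsTorsionFlagBasis μ →
       MatrixOfT ν N → MatrixOfT μ M → FlagIso ν μ → Conj N M)
  -- injective: U^*_n-conjugate matrices come from isomorphic flags
  × (∀ (ν μ : Fin n → Sm m) (N M : Mat n) →
       IsTorsionFlagBasis ν → IsTorsionFlagBasis μ →
       MatrixOfT ν N → MatrixOfT μ M → Conj N M → FlagIso ν μ)
  -- surjective onto the U^*_n-conjugacy classes in U^o_{n,m}
  × (∀ (N : Mat n) → Uo[ n , m ] N →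
       Σ (Fin n → Sm m) λ ν → IsTorsionFlagBasis ν ×
         Σ (Mat n) (λ M → MatrixOfT ν M × Conj M N))
  -- the T-order of [V] is n - rank N
  × (∀ (ν : Fin n → Sm m) (N : Mat n) (r : ℕ) →
       IsTorsionFlagBasis ν → MatrixOfT ν N → Rank N r →
       HasTOrder ν (n ∸ r))
proposition3p6 F n m _ _ =
  matrixOfT-exists , matrixOfT-∈Uo , flagIso⇒conj , conj⇒flagIso , Uo-realised , tOrder≡n∸rank
  where open TorsionFlags F m
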